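{- Each of the following marked tuples is a flippable tuple: $\alpha(w)=\{(1w11000,|w|+5),\,(1w10100,|w|+6),\,(1w10010,|w|+2)\}$ for every Dyck word $w\in D$; $\beta=\{(111000,6),(101100,5),(101010,1)\}$; $\gamma=\{(11001100,2),(11011000,8),(11101000,6)\}$; $\delta=\{(111000,6),(110100,5),(101100,3),(101010,1)\}$.
   Context: Bitstrings: $\epsilon$ empty, $xy$ concatenation, $|x|$ length, $\overline{x}$ complement. $B_k$ is the set of bitstrings of length $2k$ with $k$ or $k+1$ ones; $G_k$ is the graph on $B_k$ whose edges join bitstrings differing in exactly one bit. $D_k$ is the set of bitstrings of length $2k$ with $k$ ones in which every prefix has at least as many ones as zeros; $D=\bigcup_{k\ge0}D_k$. Every nonempty $x\in D$ decomposes uniquely as $x=1u0v$ with $u,v\in D$. For $x=b_1\cdots b_{2k}$ let $\widetilde{x}:=\overline{b_{2k}\cdots b_1}$. For an integer sequence $\pi=(a_1,\ldots,a_n)$ and integer $a$, $a\pm\pi:=(a\pm a_1,\ldots,a\pm a_n)$. Define $\pi(\epsilon)=()$ and $\pi(1u0v)=\bigl(|u|+2,\,(|u|+2)-\pi(\widetilde{u}),\,1,\,(|u|+2)+\pi(v)\bigr)$. For $x\in D_k$ with $\pi(x)=(a_1,\ldots,a_{2k})$, $P(x)=(x_0,\ldots,x_{2k})$ with $x_0=x$ and $x_i$ obtained from $x_{i-1}$ by flipping bit $a_i$; it is a path in $G_k$, and $\mathcal{P}_k=\{P(x):x\in D_k\}$. $e(x,i)$ is the edge of $P(x)$ along which bit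 $i$ is flipped. A flipping cycle on $D_k$ is a cycle of length $2\ell$ in $G_k$ sharing exactly $\ell$ edges with $\ell$ distinct paths of $\mathcal{P}_k$, one edge with each. A marked Dyck word is $(x,m)$ with $x\in D_k$, $m\in[2k]$ (the $m$th bit is marked). A marked tuple $\tau=\{(x_1,m_1),\ldots,(x_\ell,m_\ell)\}$, $\ell\ge3$, with distinct $x_i\in D_k$ is a flippable tuple if some flipping $2\ell$-cycle in $G_k$ contains exactly the edges $e(x_1,m_1),\ldots,e(x_\ell,m_\ell)$ of the paths $P(x_1),\ldots,P(x_\ell)$. -}

module Defs where

open import Data.Bool using (Bool; true; false; not; _xor_)
open import Data.Nat using (ℕ; zero; suc; _+_; _*_; _∸_; _≤_; _≟_)
open import Data.List using (List; []; _∷_; _++_; length; map; reverse; zip; zipWith; sum)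
open import Data.List.Relation.Unary.All using (All)
open import Data.List.Relation.Unary.Any using (Any)
open import Data.List.Relation.Unary.AllPairs using (AllPairs)
open import Data.List.Relation.Unary.Unique.Propositional using (Unique)
open import Data.List.Relation.Binary.Pointwise using (Pointwise)
open import Data.List.Membership.Propositional using (_∈_; _∉_)
open import Data.Maybe using (Maybe; just; nothing)
open import Data.Product using (_×_; _,_; Σ; ∃; proj₁; proj₂)
open import Data.Sum using (_⊎_)
open import Relation.Binary.PropositionalEquality using (_≡_)
open import Relation.Nullary using (¬_; yes; no)

-- Bitstrings: true = 1, false = 0. Bits are indexed from 1.
Bits : Set
Bits = List Bool

I O : Bool
I = true
O = false

ones : Bits → ℕ
ones [] = 0
ones (true ∷ xs) = suc (ones xs)
ones (false ∷ xs) = ones xs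

zeros : Bits → ℕ
zeros [] = 0
zeros (true ∷ xs) = zeros xs
zeros (false ∷ xs) = suc (zeros xs)

compl : Bits → Bits
compl = map not

tilde : Bits → Bits
tilde x = compl (reverse x)

InD : ℕ → Bits → Set
InD k x = (length x ≡ 2 * k) × (ones x ≡ k) ×
          (∀ (p s : Bits) → p ++ s ≡ x → zeros p ≤ ones p)

InDAny : Bits → Set
InDAny x = Σ ℕ λ k → InD k x

InB : ℕ → Bits → Set
InB k x = (length x ≡ 2 * k) × ((ones x ≡ k) ⊎ (ones x ≡ suc k))

hamming : Bits → Bits → ℕ
hamming [] _ = 0
hamming (_ ∷ _) [] = 0
hamming (a ∷ as) (b ∷ bs) with a xor b
... | true = suc (hamming as bs)
... | false = hamming as bs

-- adjacency in G_k (vertices are assumed in B_k separately)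
Adjacent : Bits → Bits → Set
Adjacent a b = (length a ≡ length b) × (hamming a b ≡ 1)

-- flip bit i (1-based)
flipAt : ℕ → Bits → Bits
flipAt zero xs = xs
flipAt (suc _) [] = []
flipAt (suc zero) (b ∷ bs) = not b ∷ bs
flipAt (suc (suc n)) (b ∷ bs) = b ∷ flipAt (suc n) bs

-- For x = 1 rest with x = 1u0v, `split 0 rest` returns (u , v).
split : ℕ → Bits → Bits × Bits
split d [] = [] , []
split zero (false ∷ xs) = [] , xs
split (suc d) (false ∷ xs) = let r = split d xs in false ∷ proj₁ r , proj₂ r
split d (true ∷ xs) = let r = split (suc d) xs in true ∷ proj₁ r , proj₂ r

-- π with fuel (fuel = length suffices on Dyck words)
piF : ℕ → Bits → List ℕ
piF zero _ = []
piF (suc n) [] = []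
piF (suc n) (false ∷ _) = []
piF (suc n) (true ∷ rest) =
  let u = proj₁ (split 0 rest)
      v = proj₂ (split 0 rest)
      c = length u + 2
  in c ∷ (map (c ∸_) (piF n (tilde u)) ++ (1 ∷ map (c +_) (piF n v)))

π : Bits → List ℕ
π x = piF (length x) x

walk : Bits → List ℕ → List Bits
walk x [] = x ∷ []
walk x (a ∷ as) = x ∷ walk (flipAt a x) as

P : Bits → List Bits
P x = walk x (π x)

Edge : Set
Edge = Bits × Bits

consec : List Bits → List Edge
consec [] = []
consec (a ∷ []) = []
consec (a ∷ b ∷ rest) = (a , b) ∷ consec (b ∷ rest)

cycleEdges : List Bits → List Edge
cycleEdges [] = []
cycleEdges (v ∷ vs) = consec ((v ∷ vs) ++ (v ∷ []))

pathEdges : Bits → List Edge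
pathEdges x = consec (P x)

edgeLookup : List Edge → List ℕ → ℕ → Maybe Edge
edgeLookup (e ∷ es) (a ∷ as) i with a ≟ i
... | yes _ = just e
... | no _ = edgeLookup es as i
edgeLookup _ _ i = nothing

e : Bits → ℕ → Maybe Edge
e x i = edgeLookup (pathEdges x) (π x) i

-- edges are undirected
SameEdge : Edge → Edge → Set
SameEdge (a , b) (c , d) = ((a ≡ c) × (b ≡ d)) ⊎ ((a ≡ d) × (b ≡ c))

_∈E_ : Edge → List Edge → Set
f ∈E es = Any (SameEdge f) es

IsCycle : ℕ → List Bits → Set
IsCycle k C = (3 ≤ length C) × All (InB k) C × Unique C ×
              All (λ f → Adjacent (proj₁ f) (proj₂ f)) (cycleEdges C)

MarkedTuple : Set
MarkedTuple = List (Bits × ℕ)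

Flippable : ℕ → MarkedTuple → Set
Flippable k τ =
  (3 ≤ length τ) ×
  All (λ xm → InD k (proj₁ xm) × (1 ≤ proj₂ xm) × (proj₂ xm ≤ 2 * k)) τ ×
  Unique (map proj₁ τ) ×
  Σ (List Bits) λ C → IsCycle k C × (length C ≡ 2 * length τ) ×
  Σ (List Edge) λ es →
    Pointwise (λ xm f → e (proj₁ xm) (proj₂ xm) ≡ just f) τ es ×
    AllPairs (λ f g → ¬ SameEdge f g) es ×
    Pointwise (λ xm f → (f ∈E cycleEdges C) ×
                 (∀ g → g ∈E cycleEdges C → g ∈E pathEdges (proj₁ xm) → SameEdge g f))
              τ es ×
    (∀ y → InD k y → y ∉ map proj₁ τ →
       ∀ g → g ∈E cycleEdges C → ¬ (g ∈E pathEdges y))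

α : Bits → MarkedTuple
α w = ((I ∷ w) ++ (I ∷ I ∷ O ∷ O ∷ O ∷ []) , length w + 5) ∷
      ((I ∷ w) ++ (I ∷ O ∷ I ∷ O ∷ O ∷ []) , length w + 6) ∷
      ((I ∷ w) ++ (I ∷ O ∷ O ∷ I ∷ O ∷ []) , length w + 2) ∷ []

β : MarkedTuple
β = (I ∷ I ∷ I ∷ O ∷ O ∷ O ∷ [] , 6) ∷
    (I ∷ O ∷ I ∷ I ∷ O ∷ O ∷ [] , 5) ∷
    (I ∷ O ∷ I ∷ O ∷ I ∷ O ∷ [] , 1) ∷ []

γ : MarkedTuple
γ = (I ∷ I ∷ O ∷ O ∷ I ∷ I ∷ O ∷ O ∷ [] , 2) ∷
    (I ∷ I ∷ O ∷ I ∷ I ∷ O ∷ O ∷ O ∷ [] , 8) ∷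
    (I ∷ I ∷ I ∷ O ∷ I ∷ O ∷ O ∷ O ∷ [] , 6) ∷ []

δ : MarkedTuple
δ = (I ∷ I ∷ I ∷ O ∷ O ∷ O ∷ [] , 6) ∷
    (I ∷ I ∷ O ∷ I ∷ O ∷ O ∷ [] , 5) ∷
    (I ∷ O ∷ I ∷ I ∷ O ∷ O ∷ [] , 3) ∷
    (I ∷ O ∷ I ∷ O ∷ I ∷ O ∷ [] , 1) ∷ []

module Submission where

-- β, γ, δ are finite: every clause of `Flippable` has a decidable counterpart
-- (`Certificate`), checked by evaluation for an explicit cycle and marked edges.
-- α(w) needs an argument uniform in the Dyck word w; its flipping cycle is the
-- hexagon 1w·S for six fixed 5-bit suffixes S.  Paths are analysed through the
-- recursion π(1u0v) = (c, c − π(ũ), 1, c + π(v)): P(1u0v) is a first step, a copy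
-- of P(ũ), a middle step and a copy of P(v) (`NodePath`), and an edge of P(xr)
-- whose ends share the Dyck suffix r comes from P(x) (`edge-suffix`).  Hence a
-- hexagon edge on P(y) forces y = 1wt for one of three suffixes t, found by a
-- finite check (`hexagon-edge-on-path`); this gives the uniqueness and avoidance
-- clauses, and the marked edges are read off from prefixes of π (`marked-edge`).

open import Defs
open import Data.Nat using (ℕ; _+_)
open import Data.Product using (_×_)

open import Data.Bool using (Bool; true; false; not)
import Data.Bool as Bool
open import Data.Bool.Properties using (not-involutive; not-¬)
open import Data.Nat using (zero; suc; _*_; _∸_; _≤_; z≤n; s≤s; s≤s⁻¹; _≟_; _≤?_)
open import Data.Nat.Properties
open import Data.Product using (Σ; _,_; proj₁; proj₂)
open import Data.Product.Properties using () renaming (≡-dec to ×-≡-dec)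
open import Data.Sum using (_⊎_; inj₁; inj₂)
open import Data.Empty using (⊥; ⊥-elim)
open import Data.Maybe using (Maybe; just)
import Data.Maybe.Properties as Maybe
open import Function using (_∘_; id)
open import Data.List using (List; []; _∷_; _++_; length; map; reverse)
open import Data.List.Properties
  using (≡-dec; ∷-injective; ∷-injectiveˡ; ∷-injectiveʳ; ++-cancelˡ; ++-cancelʳ; ++-assoc; ++-identityʳ;
         length-++; length-map; length-reverse; map-++; reverse-++; map-id; map-∘; map-cong)
open import Data.List.Relation.Unary.All as All using (All; []; _∷_; all?; lookup)
open import Data.List.Relation.Unary.All.Properties using (++⁺; map⁺)
open import Data.List.Relation.Unary.Any using (Any; here; there; any?)
open import Data.List.Relation.Unary.AllPairs as AllPairs using (AllPairs; allPairs?)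
open import Data.List.Relation.Unary.AllPairs.Properties using () renaming (map⁺ to allPairs-map⁺)
open import Data.List.Relation.Unary.Unique.Propositional using (Unique)
open import Data.List.Relation.Unary.Unique.Propositional.Properties using () renaming (map⁺ to unique-map⁺)
open import Data.List.Relation.Binary.Pointwise as Pointwise using (Pointwise; []; _∷_)
open import Data.List.Membership.Propositional using (_∈_; _∉_; find)
open import Data.List.Membership.Propositional.Properties using (∈-map⁻; ∈-map⁺; ∈-++⁻; ∈-++⁺ˡ; ∈-++⁺ʳ)
open import Relation.Binary.PropositionalEquality
open import Relation.Binary.Definitions using (DecidableEquality)
open import Relation.Nullary using (¬_; Dec; yes; no)
open import Relation.Nullary.Decidable
  using (map′; True; toWitness; from-yes; from-no; _×-dec_; _⊎-dec_; _→-dec_; ¬?)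


data HeightPath : ℕ → Bits → ℕ → Set where
  flat : ∀ {h} → HeightPath h [] h
  up   : ∀ {h x h'} → HeightPath (suc h) x h' → HeightPath h (true ∷ x) h'
  down : ∀ {h x h'} → HeightPath h x h' → HeightPath (suc h) (false ∷ x) h'

data Dyck : Bits → Set where
  empty : Dyck []
  node  : ∀ {u v} → Dyck u → Dyck v → Dyck (true ∷ u ++ false ∷ v)

heightPath-++ : ∀ {h a m b h'} → HeightPath h a m → HeightPath m b h' → HeightPath h (a ++ b) h'
heightPath-++ flat q = q
heightPath-++ (up p) q = up (heightPath-++ p q)
heightPath-++ (down p) q = down (heightPath-++ p q)

heightPath-split : ∀ {h} a {b h'} → HeightPath h (a ++ b) h' →
                   Σ ℕ λ m → HeightPath h a m × HeightPath m b h'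
heightPath-split [] p = _ , flat , p
heightPath-split (true ∷ a) (up p) with heightPath-split a p
... | m , q , r = m , up q , r
heightPath-split (false ∷ a) (down p) with heightPath-split a p
... | m , q , r = m , down q , r

heightPath-count : ∀ {h x h'} → HeightPath h x h' → ones x + h ≡ zeros x + h'
heightPath-count flat = refl
heightPath-count {h} (up {x = x} p) = trans (sym (+-suc (ones x) h)) (heightPath-count p)
heightPath-count {suc h} (down {x = x} p) = trans (+-suc (ones x) h) (cong suc (heightPath-count p))

dyck→heightPath : ∀ {x} → Dyck x → ∀ {h} → HeightPath h x h
dyck→heightPath empty = flat
dyck→heightPath (node du dv) = up (heightPath-++ (dyck→heightPath du) (down (dyck→heightPath dv)))

dyck-++ : ∀ {a b} → Dyck a → Dyck b → Dyck (a ++ b)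
dyck-++ empty db = db
dyck-++ {b = b} (node {u} {v} du dv) db =
  subst Dyck (cong (true ∷_) (sym (++-assoc u (false ∷ v) b))) (node du (dyck-++ dv db))

-- `Blocks h x`: x = d₀ 0 d₁ 0 ⋯ 0 d_h with Dyck words d_i; this is the shape of the
-- words read by a height path from h down to 0.
data Blocks : ℕ → Bits → Set where
  final : ∀ {d} → Dyck d → Blocks 0 d
  block : ∀ {h d x} → Dyck d → Blocks h x → Blocks (suc h) (d ++ false ∷ x)

prepend-node : ∀ {h d x} → Dyck d → Blocks h x → Blocks h (true ∷ d ++ false ∷ x)
prepend-node dd (final de) = final (node dd de)
prepend-node {d = d} dd (block {d = e} {x} de bs) =
  subst (Blocks _) (cong (true ∷_) (++-assoc d (false ∷ e) (false ∷ x))) (block (node dd de) bs)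

heightPath→blocks : ∀ {h x} → HeightPath h x 0 → Blocks h x
heightPath→blocks flat = final empty
heightPath→blocks (up p) with heightPath→blocks p
... | block dd bs = prepend-node dd bs
heightPath→blocks (down p) = block empty (heightPath→blocks p)

heightPath→dyck : ∀ {x} → HeightPath 0 x 0 → Dyck x
heightPath→dyck p with heightPath→blocks p
... | final d = d

heightPath? : ∀ h x → Dec (HeightPath h x 0)
heightPath? zero [] = yes flat
heightPath? (suc h) [] = no (λ ())
heightPath? h (true ∷ x) = map′ up (λ { (up p) → p }) (heightPath? (suc h) x)
heightPath? zero (false ∷ x) = no (λ ())
heightPath? (suc h) (false ∷ x) = map′ down (λ { (down p) → p }) (heightPath? h x)

dyck? : ∀ x → Dec (Dyck x)
dyck? x = map′ heightPath→dyck (λ d → dyck→heightPath d) (heightPath? 0 x)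

dyck-balanced : ∀ {x} → Dyck x → ones x ≡ zeros x
dyck-balanced d = trans (sym (+-identityʳ _)) (trans (heightPath-count (dyck→heightPath d {0})) (+-identityʳ _))

dyck-prefix : ∀ x {r} → Dyck (x ++ r) → Dyck r → Dyck x
dyck-prefix x {r} d dr with heightPath-split x (dyck→heightPath d {0})
... | m , p , q = heightPath→dyck (subst (HeightPath 0 x) m≡0 p)
  where
  m≡0 : m ≡ 0
  m≡0 = +-cancelˡ-≡ (zeros r) _ _ (trans (cong (_+ m) (sym (dyck-balanced dr))) (heightPath-count q))

dyck-suffix : ∀ w {m} → Dyck w → Dyck (w ++ m) → Dyck m
dyck-suffix w {m} dw d with heightPath-split w (dyck→heightPath d {0})
... | k , p , q = heightPath→dyck (subst (λ h → HeightPath h m 0) k≡0 q)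
  where
  k≡0 : k ≡ 0
  k≡0 = sym (+-cancelˡ-≡ (zeros w) 0 k (trans (cong (_+ 0) (sym (dyck-balanced dw))) (heightPath-count p)))

-- A Dyck word never ends in 1v with v a Dyck word: the height would end at 1.
dyck-not-ending-1dyck : ∀ {r v} q → Dyck r → Dyck v → ¬ (r ≡ q ++ true ∷ v)
dyck-not-ending-1dyck {v = v} q dr dv refl with heightPath-split q (dyck→heightPath dr {0})
... | m , _ , up p = 1+n≢0 (+-cancelˡ-≡ (zeros v) (suc m) 0
                       (trans (cong (_+ suc m) (sym (dyck-balanced dv))) (heightPath-count p)))

length-ones-zeros : ∀ x → length x ≡ ones x + zeros x
length-ones-zeros [] = refl
length-ones-zeros (true ∷ x) = cong suc (length-ones-zeros x)
length-ones-zeros (false ∷ x) = trans (cong suc (length-ones-zeros x)) (sym (+-suc (ones x) (zeros x)))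

ones-++ : ∀ a b → ones (a ++ b) ≡ ones a + ones b
ones-++ [] b = refl
ones-++ (true ∷ a) b = cong suc (ones-++ a b)
ones-++ (false ∷ a) b = ones-++ a b

hamming-++ : ∀ p a b → hamming (p ++ a) (p ++ b) ≡ hamming a b
hamming-++ [] a b = refl
hamming-++ (true ∷ p) a b = hamming-++ p a b
hamming-++ (false ∷ p) a b = hamming-++ p a b

prefixes→heightPath : ∀ x h → (∀ (p s : Bits) → p ++ s ≡ x → zeros p ≤ h + ones p) →
                      ones x + h ≡ zeros x → HeightPath h x 0
prefixes→heightPath [] h _ balance = subst (λ k → HeightPath k [] 0) (sym balance) flat
prefixes→heightPath (true ∷ x) h prefixes balance =
  up (prefixes→heightPath x (suc h) prefixes' (trans (+-suc (ones x) h) balance))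
  where
  prefixes' : ∀ (p s : Bits) → p ++ s ≡ x → zeros p ≤ suc h + ones p
  prefixes' p s eq = subst (zeros p ≤_) (+-suc h (ones p)) (prefixes (true ∷ p) s (cong (true ∷_) eq))
prefixes→heightPath (false ∷ x) zero prefixes _ with prefixes (false ∷ []) x refl
... | ()
prefixes→heightPath (false ∷ x) (suc h) prefixes balance =
  down (prefixes→heightPath x h prefixes' (suc-injective (trans (sym (+-suc (ones x) h)) balance)))
  where
  prefixes' : ∀ (p s : Bits) → p ++ s ≡ x → zeros p ≤ h + ones p
  prefixes' p s eq = s≤s⁻¹ (prefixes (false ∷ p) s (cong (false ∷_) eq))

InD→Dyck : ∀ {k x} → InD k x → Dyck x
InD→Dyck {k} {x} (len , ones≡k , prefixes) =
  heightPath→dyck (prefixes→heightPath x 0 prefixes (trans (+-identityʳ _) balanced))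
  where
  zeros≡k : zeros x ≡ k
  zeros≡k = +-cancelˡ-≡ k _ _ (begin
    k + zeros x           ≡⟨ cong (_+ zeros x) (sym ones≡k) ⟩
    ones x + zeros x      ≡⟨ sym (length-ones-zeros x) ⟩
    length x              ≡⟨ len ⟩
    k + (k + 0)           ≡⟨ cong (k +_) (+-identityʳ k) ⟩
    k + k                 ∎)
    where open ≡-Reasoning
  balanced : ones x ≡ zeros x
  balanced = trans ones≡k (sym zeros≡k)

Dyck→InD : ∀ {k x} → Dyck x → length x ≡ 2 * k → InD k x
Dyck→InD {k} {x} d len = len , ones≡k , prefixes
  where
  ones≡k : ones x ≡ k
  ones≡k = *-cancelˡ-≡ (ones x) k 2 (begin
    ones x + (ones x + 0) ≡⟨ cong (ones x +_) (trans (+-identityʳ _) (dyck-balanced d)) ⟩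
    ones x + zeros x      ≡⟨ sym (length-ones-zeros x) ⟩
    length x              ≡⟨ len ⟩
    2 * k                 ∎)
    where open ≡-Reasoning
  prefixes : ∀ (p s : Bits) → p ++ s ≡ x → zeros p ≤ ones p
  prefixes p s refl with heightPath-split p (dyck→heightPath d {0})
  ... | m , q , _ = subst (zeros p ≤_) (trans (sym (heightPath-count q)) (+-identityʳ _)) (m≤m+n (zeros p) m)

tilde-++ : ∀ a b → tilde (a ++ b) ≡ tilde b ++ tilde a
tilde-++ a b = trans (cong compl (reverse-++ a b)) (map-++ not (reverse b) (reverse a))

tilde-involutive : ∀ a → tilde (tilde a) ≡ a
tilde-involutive [] = refl
tilde-involutive (x ∷ a) = begin
  tilde (tilde (x ∷ a))              ≡⟨ cong tilde (tilde-++ (x ∷ []) a) ⟩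
  tilde (tilde a ++ (not x ∷ []))    ≡⟨ tilde-++ (tilde a) (not x ∷ []) ⟩
  not (not x) ∷ tilde (tilde a)      ≡⟨ cong₂ _∷_ (not-involutive x) (tilde-involutive a) ⟩
  x ∷ a                              ∎
  where open ≡-Reasoning

length-tilde : ∀ a → length (tilde a) ≡ length a
length-tilde a = trans (length-map not (reverse a)) (length-reverse a)

tilde-solve : ∀ {z} w q → tilde z ≡ w ++ q → z ≡ tilde q ++ tilde w
tilde-solve {z} w q eq = trans (sym (tilde-involutive z)) (trans (cong tilde eq) (tilde-++ w q))

dyck-tilde : ∀ {u} → Dyck u → Dyck (tilde u)
dyck-tilde empty = empty
dyck-tilde (node {u} {v} du dv) =
  subst Dyck (sym tilde-node) (dyck-++ (dyck-tilde dv) (node (dyck-tilde du) empty))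
  where
  open ≡-Reasoning
  tilde-node : tilde (true ∷ u ++ false ∷ v) ≡ tilde v ++ (true ∷ tilde u ++ false ∷ [])
  tilde-node = begin
    tilde ((true ∷ u) ++ false ∷ v)                         ≡⟨ tilde-++ (true ∷ u) (false ∷ v) ⟩
    tilde (false ∷ v) ++ tilde (true ∷ u)                   ≡⟨ cong₂ _++_ (tilde-++ (false ∷ []) v) (tilde-++ (true ∷ []) u) ⟩
    (tilde v ++ (true ∷ [])) ++ (tilde u ++ (false ∷ []))   ≡⟨ ++-assoc (tilde v) _ _ ⟩
    tilde v ++ (true ∷ tilde u ++ false ∷ [])               ∎

split-1 : ∀ d xs → split d (true ∷ xs) ≡ (true ∷ proj₁ (split (suc d) xs) , proj₂ (split (suc d) xs))
split-1 zero xs = refl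
split-1 (suc d) xs = refl

split-dyck : ∀ {u} → Dyck u → ∀ d rest →
             split d (u ++ rest) ≡ (u ++ proj₁ (split d rest) , proj₂ (split d rest))
split-dyck empty d rest = refl
split-dyck (node {u} {v} du dv) d rest = begin
  split d (true ∷ (u ++ false ∷ v) ++ rest)
    ≡⟨ cong (λ z → split d (true ∷ z)) (++-assoc u (false ∷ v) rest) ⟩
  split d (true ∷ u ++ false ∷ v ++ rest)
    ≡⟨ split-1 d _ ⟩
  (true ∷ proj₁ (split (suc d) (u ++ false ∷ v ++ rest)) , proj₂ (split (suc d) (u ++ false ∷ v ++ rest)))
    ≡⟨ cong (λ r → (true ∷ proj₁ r , proj₂ r)) (split-dyck du (suc d) (false ∷ v ++ rest)) ⟩
  (true ∷ u ++ false ∷ proj₁ (split d (v ++ rest)) , proj₂ (split d (v ++ rest)))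
    ≡⟨ cong (λ r → (true ∷ u ++ false ∷ proj₁ r , proj₂ r)) (split-dyck dv d rest) ⟩
  (true ∷ u ++ false ∷ v ++ proj₁ (split d rest) , proj₂ (split d rest))
    ≡⟨ cong (λ z → (true ∷ z , proj₂ (split d rest))) (sym (++-assoc u (false ∷ v) (proj₁ (split d rest)))) ⟩
  ((true ∷ u ++ false ∷ v) ++ proj₁ (split d rest) , proj₂ (split d rest)) ∎
  where open ≡-Reasoning

split-node : ∀ {u} → Dyck u → ∀ v → split 0 (u ++ false ∷ v) ≡ (u , v)
split-node {u} du v = trans (split-dyck du 0 (false ∷ v)) (cong (_, v) (++-identityʳ u))

-- `split` returns no longer words, so the fuel of `piF` suffices.
split-length : ∀ d xs → (length (proj₁ (split d xs)) ≤ length xs) × (length (proj₂ (split d xs)) ≤ length xs)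
split-length d [] = z≤n , z≤n
split-length zero (false ∷ xs) = z≤n , n≤1+n _
split-length (suc d) (false ∷ xs) =
  s≤s (proj₁ (split-length d xs)) , m≤n⇒m≤1+n (proj₂ (split-length d xs))
split-length zero (true ∷ xs) =
  s≤s (proj₁ (split-length 1 xs)) , m≤n⇒m≤1+n (proj₂ (split-length 1 xs))
split-length (suc d) (true ∷ xs) =
  s≤s (proj₁ (split-length (suc (suc d)) xs)) , m≤n⇒m≤1+n (proj₂ (split-length (suc (suc d)) xs))

piF-fuel : ∀ n m x → length x ≤ n → length x ≤ m → piF n x ≡ piF m x
piF-fuel zero zero [] _ _ = refl
piF-fuel zero (suc m) [] _ _ = refl
piF-fuel (suc n) zero [] _ _ = refl
piF-fuel (suc n) (suc m) [] _ _ = refl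
piF-fuel (suc n) (suc m) (false ∷ x) _ _ = refl
piF-fuel (suc n) (suc m) (true ∷ rest) (s≤s ln) (s≤s lm) =
  cong₂ (λ A B → c ∷ (map (c ∸_) A ++ (1 ∷ map (c +_) B)))
    (piF-fuel n m (tilde u) (bound-u ln) (bound-u lm))
    (piF-fuel n m v (≤-trans (proj₂ lengths) ln) (≤-trans (proj₂ lengths) lm))
  where
  u : Bits
  u = proj₁ (split 0 rest)
  v : Bits
  v = proj₂ (split 0 rest)
  c : ℕ
  c = length u + 2
  lengths : (length u ≤ length rest) × (length v ≤ length rest)
  lengths = split-length 0 rest
  bound-u : ∀ {k} → length rest ≤ k → length (tilde u) ≤ k
  bound-u l = subst (_≤ _) (sym (length-tilde u)) (≤-trans (proj₁ lengths) l)

length-node : ∀ u v → length (true ∷ u ++ false ∷ v) ≡ suc (length u + suc (length v))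
length-node u v = cong suc (length-++ u)

π-node : ∀ {u v} → Dyck u → Dyck v →
         π (true ∷ u ++ false ∷ v) ≡
         (length u + 2) ∷ (map ((length u + 2) ∸_) (π (tilde u)) ++ (1 ∷ map ((length u + 2) +_) (π v)))
π-node {u} {v} du dv rewrite split-node du v =
  cong₂ (λ A B → (length u + 2) ∷ (map ((length u + 2) ∸_) A ++ (1 ∷ map ((length u + 2) +_) B)))
    (piF-fuel _ _ (tilde u) bound-u ≤-refl) (piF-fuel _ _ v bound-v ≤-refl)
  where
  L : ℕ
  L = length (u ++ false ∷ v)
  bound-u : length (tilde u) ≤ L
  bound-u = subst (_≤ L) (sym (length-tilde u)) (subst (length u ≤_) (sym (length-++ u)) (m≤m+n _ _))
  bound-v : length v ≤ L
  bound-v = subst (length v ≤_) (sym (length-++ u)) (≤-trans (n≤1+n _) (m≤n+m _ _))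

-- Induction over Dyck words 1u0v with hypotheses for ũ and v, the two words
-- on which π recurses.
module _ (Pr : Bits → Set) (base : Pr [])
         (step : ∀ {u v} → Dyck u → Dyck v → Pr (tilde u) → Pr v → Pr (true ∷ u ++ false ∷ v)) where
  private
    induction-fuel : ∀ n x → length x ≤ n → Dyck x → Pr x
    induction-fuel n [] _ empty = base
    induction-fuel (suc n) _ (s≤s l) (node {u} {v} du dv) =
      step du dv (induction-fuel n (tilde u) bound-u (dyck-tilde du)) (induction-fuel n v bound-v dv)
      where
      bound-u : length (tilde u) ≤ n
      bound-u = subst (_≤ n) (sym (length-tilde u)) (≤-trans (subst (length u ≤_) (sym (length-++ u)) (m≤m+n _ _)) l)
      bound-v : length v ≤ n
      bound-v = ≤-trans (subst (length v ≤_) (sym (length-++ u)) (≤-trans (n≤1+n _) (m≤n+m _ _))) l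

  dyck-induction : ∀ {x} → Dyck x → Pr x
  dyck-induction {x} d = induction-fuel (length x) x ≤-refl d

InRange : ℕ → ℕ → Set
InRange L a = (1 ≤ a) × (a ≤ L)

π-range : ∀ {x} → Dyck x → All (InRange (length x)) (π x)
π-range = dyck-induction (λ x → All (InRange (length x)) (π x)) [] step
  where
  step : ∀ {u v} → Dyck u → Dyck v →
         All (InRange (length (tilde u))) (π (tilde u)) → All (InRange (length v)) (π v) →
         All (InRange (length (true ∷ u ++ false ∷ v))) (π (true ∷ u ++ false ∷ v))
  step {u} {v} du dv range-u range-v rewrite π-node du dv | length-node u v =
    (subst (1 ≤_) (+-comm 2 (length u)) (s≤s z≤n) , c≤X) ∷
    ++⁺ (map⁺ (All.map reflect range-u)) ((s≤s z≤n , s≤s z≤n) ∷ map⁺ (All.map shift range-v))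
    where
    c : ℕ
    c = length u + 2
    X : ℕ
    X = suc (length u + suc (length v))
    c+v≡X : c + length v ≡ X
    c+v≡X = trans (+-assoc (length u) 2 (length v)) (+-suc (length u) (suc (length v)))
    c≤X : c ≤ X
    c≤X = subst (c ≤_) c+v≡X (m≤m+n c (length v))
    reflect : ∀ {a} → InRange (length (tilde u)) a → InRange X (c ∸ a)
    reflect {a} (_ , a≤) =
      subst (1 ≤_) (sym (+-∸-comm 2 a≤u)) (≤-trans (s≤s z≤n) (m≤n+m 2 (length u ∸ a))) , ≤-trans (m∸n≤m c a) c≤X
      where
      a≤u : a ≤ length u
      a≤u = subst (a ≤_) (length-tilde u) a≤
    shift : ∀ {a} → InRange (length v) a → InRange X (c + a)
    shift {a} (1≤a , a≤) = ≤-trans 1≤a (m≤n+m a c) , subst (c + a ≤_) c+v≡X (+-monoʳ-≤ c a≤)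

π-++ : ∀ {x r} → Dyck x → Dyck r → π (x ++ r) ≡ π x ++ map (length x +_) (π r)
π-++ {r = r} empty dr = sym (map-id (π r))
π-++ {r = r} (node {u} {v} du dv) dr = begin
  π ((true ∷ u ++ false ∷ v) ++ r)
    ≡⟨ cong π (cong (true ∷_) (++-assoc u (false ∷ v) r)) ⟩
  π (true ∷ u ++ false ∷ (v ++ r))
    ≡⟨ π-node du (dyck-++ dv dr) ⟩
  c ∷ (reflected ++ 1 ∷ map (c +_) (π (v ++ r)))
    ≡⟨ cong (λ q → c ∷ (reflected ++ 1 ∷ map (c +_) q)) (π-++ dv dr) ⟩
  c ∷ (reflected ++ 1 ∷ map (c +_) (π v ++ map (length v +_) (π r)))
    ≡⟨ cong (λ q → c ∷ (reflected ++ 1 ∷ q)) (map-++ (c +_) (π v) _) ⟩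
  c ∷ (reflected ++ 1 ∷ (shifted ++ map (c +_) (map (length v +_) (π r))))
    ≡⟨ cong (λ q → c ∷ (reflected ++ 1 ∷ (shifted ++ q))) shift-shift ⟩
  c ∷ (reflected ++ 1 ∷ (shifted ++ tail))
    ≡⟨ cong (c ∷_) (sym (++-assoc reflected (1 ∷ shifted) tail)) ⟩
  (c ∷ (reflected ++ 1 ∷ shifted)) ++ tail
    ≡⟨ cong (_++ tail) (sym (π-node du dv)) ⟩
  π (true ∷ u ++ false ∷ v) ++ tail ∎
  where
  open ≡-Reasoning
  c : ℕ
  c = length u + 2
  reflected : List ℕ
  reflected = map (c ∸_) (π (tilde u))
  shifted : List ℕ
  shifted = map (c +_) (π v)
  tail : List ℕ
  tail = map (length (true ∷ u ++ false ∷ v) +_) (π r)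
  c+v : c + length v ≡ length (true ∷ u ++ false ∷ v)
  c+v = trans (+-assoc (length u) 2 (length v)) (trans (+-suc (length u) (suc (length v))) (sym (length-node u v)))
  shift-shift : map (c +_) (map (length v +_) (π r)) ≡ tail
  shift-shift = trans (sym (map-∘ (π r))) (map-cong (λ a → trans (sym (+-assoc c (length v) a)) (cong (_+ a) c+v)) (π r))

flip-length : ∀ a x → length (flipAt a x) ≡ length x
flip-length zero x = refl
flip-length (suc a) [] = refl
flip-length (suc zero) (b ∷ x) = refl
flip-length (suc (suc a)) (b ∷ x) = cong suc (flip-length (suc a) x)

flip-changes : ∀ a x → 1 ≤ a → a ≤ length x → x ≢ flipAt a x
flip-changes (suc zero) (b ∷ x) _ _ eq = not-¬ refl (∷-injectiveˡ eq)
flip-changes (suc (suc a)) (b ∷ x) _ (s≤s a≤x) eq = flip-changes (suc a) x (s≤s z≤n) a≤x (∷-injectiveʳ eq)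

flip-++ˡ : ∀ a x r → a ≤ length x → flipAt a (x ++ r) ≡ flipAt a x ++ r
flip-++ˡ zero x r _ = refl
flip-++ˡ (suc zero) (b ∷ x) r _ = refl
flip-++ˡ (suc (suc a)) (b ∷ x) r (s≤s l) = cong (b ∷_) (flip-++ˡ (suc a) x r l)

flip-++ʳ : ∀ T r b → flipAt (length T + suc b) (T ++ r) ≡ T ++ flipAt (suc b) r
flip-++ʳ [] r b = refl
flip-++ʳ (t ∷ []) r b = refl
flip-++ʳ (t ∷ t' ∷ T) r b = cong (t ∷_) (flip-++ʳ (t' ∷ T) r b)

flip-middle : ∀ u b v → flipAt (suc (length u)) (u ++ b ∷ v) ≡ u ++ not b ∷ v
flip-middle [] b v = refl
flip-middle (x ∷ []) b v = refl
flip-middle (x ∷ y ∷ u) b v = cong (x ∷_) (flip-middle (y ∷ u) b v)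

flip-compl : ∀ a x → flipAt a (compl x) ≡ compl (flipAt a x)
flip-compl zero x = refl
flip-compl (suc a) [] = refl
flip-compl (suc zero) (b ∷ x) = refl
flip-compl (suc (suc a)) (b ∷ x) = cong (not b ∷_) (flip-compl (suc a) x)

flip-reverse : ∀ a z → 1 ≤ a → a ≤ length z → flipAt (suc (length z) ∸ a) (reverse z) ≡ reverse (flipAt a z)
flip-reverse (suc zero) (b ∷ z) _ _ = begin
  flipAt (suc (length z)) (reverse (b ∷ z))
    ≡⟨ cong (flipAt (suc (length z))) (reverse-++ (b ∷ []) z) ⟩
  flipAt (suc (length z)) (reverse z ++ b ∷ [])
    ≡⟨ cong (λ k → flipAt (suc k) (reverse z ++ b ∷ [])) (sym (length-reverse z)) ⟩
  flipAt (suc (length (reverse z))) (reverse z ++ b ∷ [])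
    ≡⟨ flip-middle (reverse z) b [] ⟩
  reverse z ++ not b ∷ []
    ≡⟨ sym (reverse-++ (not b ∷ []) z) ⟩
  reverse (not b ∷ z) ∎
  where open ≡-Reasoning
flip-reverse (suc (suc a)) (b ∷ z) _ (s≤s l) = begin
  flipAt (suc (length z) ∸ suc a) (reverse (b ∷ z))
    ≡⟨ cong (flipAt (suc (length z) ∸ suc a)) (reverse-++ (b ∷ []) z) ⟩
  flipAt (suc (length z) ∸ suc a) (reverse z ++ b ∷ [])
    ≡⟨ flip-++ˡ _ (reverse z) (b ∷ []) in-range ⟩
  flipAt (suc (length z) ∸ suc a) (reverse z) ++ b ∷ []
    ≡⟨ cong (_++ b ∷ []) (flip-reverse (suc a) z (s≤s z≤n) l) ⟩
  reverse (flipAt (suc a) z) ++ b ∷ []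
    ≡⟨ sym (reverse-++ (b ∷ []) (flipAt (suc a) z)) ⟩
  reverse (b ∷ flipAt (suc a) z) ∎
  where
  open ≡-Reasoning
  in-range : suc (length z) ∸ suc a ≤ length (reverse z)
  in-range = subst (length z ∸ a ≤_) (sym (length-reverse z)) (m∸n≤m (length z) a)

flip-tilde : ∀ a z → 1 ≤ a → a ≤ length z → flipAt (suc (length z) ∸ a) (tilde z) ≡ tilde (flipAt a z)
flip-tilde a z 1≤a a≤z = trans (flip-compl _ (reverse z)) (cong compl (flip-reverse a z 1≤a a≤z))

endpoint : Bits → List ℕ → Bits
endpoint x [] = x
endpoint x (a ∷ as) = endpoint (flipAt a x) as

walk-length : ∀ x as → All (λ y → length y ≡ length x) (walk x as)
walk-length x [] = refl ∷ []
walk-length x (a ∷ as) = refl ∷ All.map (λ eq → trans eq (flip-length a x)) (walk-length (flipAt a x) as)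

endpoint-length : ∀ x as → length (endpoint x as) ≡ length x
endpoint-length x [] = refl
endpoint-length x (a ∷ as) = trans (endpoint-length (flipAt a x) as) (flip-length a x)

module _ (f : Bits → Bits) (h : ℕ → ℕ) (n : ℕ) where
  Transports : ℕ → Set
  Transports a = ∀ z → length z ≡ n → flipAt (h a) (f z) ≡ f (flipAt a z)

  walk-map : ∀ as z → length z ≡ n → All Transports as → walk (f z) (map h as) ≡ map f (walk z as)
  walk-map [] z _ _ = refl
  walk-map (a ∷ as) z lz (t ∷ ts) =
    cong (f z ∷_) (trans (cong (λ q → walk q (map h as)) (t z lz))
                         (walk-map as (flipAt a z) (trans (flip-length a z) lz) ts))

  endpoint-map : ∀ as z → length z ≡ n → All Transports as → endpoint (f z) (map h as) ≡ f (endpoint z as)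
  endpoint-map [] z _ _ = refl
  endpoint-map (a ∷ as) z lz (t ∷ ts) =
    trans (cong (λ q → endpoint q (map h as)) (t z lz))
          (endpoint-map as (flipAt a z) (trans (flip-length a z) lz) ts)

consec-cons : ∀ x y as → consec (x ∷ walk y as) ≡ (x , y) ∷ consec (walk y as)
consec-cons x y [] = refl
consec-cons x y (a ∷ as) = refl

consec-walk-++ : ∀ x as bs → consec (walk x (as ++ bs)) ≡ consec (walk x as) ++ consec (walk (endpoint x as) bs)
consec-walk-++ x [] bs = refl
consec-walk-++ x (a ∷ as) bs = begin
  consec (x ∷ walk (flipAt a x) (as ++ bs))
    ≡⟨ consec-cons x (flipAt a x) (as ++ bs) ⟩
  (x , flipAt a x) ∷ consec (walk (flipAt a x) (as ++ bs))
    ≡⟨ cong ((x , flipAt a x) ∷_) (consec-walk-++ (flipAt a x) as bs) ⟩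
  (x , flipAt a x) ∷ consec (walk (flipAt a x) as) ++ consec (walk (endpoint (flipAt a x) as) bs)
    ≡⟨ cong (_++ consec (walk (endpoint (flipAt a x) as) bs)) (sym (consec-cons x (flipAt a x) as)) ⟩
  consec (x ∷ walk (flipAt a x) as) ++ consec (walk (endpoint (flipAt a x) as) bs) ∎
  where open ≡-Reasoning

emap : (Bits → Bits) → Edge → Edge
emap f (a , b) = f a , f b

consec-map : ∀ f l → consec (map f l) ≡ map (emap f) (consec l)
consec-map f [] = refl
consec-map f (a ∷ []) = refl
consec-map f (a ∷ b ∷ l) = cong ((f a , f b) ∷_) (consec-map f (b ∷ l))

consec-All : ∀ {Q : Bits → Set} {l a b} → All Q l → (a , b) ∈ consec l → Q a × Q b
consec-All {l = x ∷ y ∷ l} (qx ∷ qy ∷ _) (here refl) = qx , qy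
consec-All {l = x ∷ y ∷ l} (_ ∷ qy ∷ ql) (there m) = consec-All (qy ∷ ql) m

pathEdge-length : ∀ {x a b} → (a , b) ∈ pathEdges x → (length a ≡ length x) × (length b ≡ length x)
pathEdge-length {x} m = consec-All (walk-length x (π x)) m

walk-proper : ∀ x as → All (InRange (length x)) as → ∀ {a b} → (a , b) ∈ consec (walk x as) → a ≢ b
walk-proper x (i ∷ as) ((1≤i , i≤x) ∷ ranges) m with subst ((_ , _) ∈_) (consec-cons x (flipAt i x) as) m
... | here refl = flip-changes i x 1≤i i≤x
... | there m' = walk-proper (flipAt i x) as (subst (λ L → All (InRange L) as) (sym (flip-length i x)) ranges) m'

pathEdge-proper : ∀ {x a b} → Dyck x → (a , b) ∈ pathEdges x → a ≢ b
pathEdge-proper {x} dx = walk-proper x (π x) (π-range dx)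

pathEdge-tilde-lengths : ∀ {x a b} → (a , b) ∈ pathEdges x → length (tilde a) ≡ length (tilde b)
pathEdge-tilde-lengths {a = a} {b} m =
  trans (length-tilde a) (trans (proj₁ (pathEdge-length m)) (trans (sym (proj₂ (pathEdge-length m))) (sym (length-tilde b))))

edgeLookup-walk : ∀ x pre i rest → i ∉ pre →
  edgeLookup (consec (walk x (pre ++ i ∷ rest))) (pre ++ i ∷ rest) i ≡ just (endpoint x pre , flipAt i (endpoint x pre))
edgeLookup-walk x [] i rest _ rewrite consec-cons x (flipAt i x) rest with i ≟ i
... | yes _ = refl
... | no i≢i = ⊥-elim (i≢i refl)
edgeLookup-walk x (a ∷ pre) i rest i∉ rewrite consec-cons x (flipAt a x) (pre ++ i ∷ rest) with a ≟ i
... | yes refl = ⊥-elim (i∉ (here refl))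
... | no _ = edgeLookup-walk (flipAt a x) pre i rest (i∉ ∘ there)

flip-reflected : ∀ z a r → 1 ≤ a → a ≤ length z →
                 flipAt ((length z + 2) ∸ a) (true ∷ tilde z ++ r) ≡ true ∷ tilde (flipAt a z) ++ r
flip-reflected (b ∷ z) (suc a) r _ (s≤s a≤z) = begin
  flipAt ((length z + 2) ∸ a) (true ∷ tilde (b ∷ z) ++ r)
    ≡⟨ cong (λ k → flipAt k (true ∷ tilde (b ∷ z) ++ r)) index ⟩
  true ∷ flipAt (suc (length z ∸ a)) (tilde (b ∷ z) ++ r)
    ≡⟨ cong (true ∷_) (flip-++ˡ _ (tilde (b ∷ z)) r in-range) ⟩
  true ∷ flipAt (suc (length z ∸ a)) (tilde (b ∷ z)) ++ r
    ≡⟨ cong (λ k → true ∷ flipAt k (tilde (b ∷ z)) ++ r) (sym (+-∸-assoc 1 a≤z)) ⟩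
  true ∷ flipAt (suc (length (b ∷ z)) ∸ suc a) (tilde (b ∷ z)) ++ r
    ≡⟨ cong (λ q → true ∷ q ++ r) (flip-tilde (suc a) (b ∷ z) (s≤s z≤n) (s≤s a≤z)) ⟩
  true ∷ tilde (flipAt (suc a) (b ∷ z)) ++ r ∎
  where
  open ≡-Reasoning
  index : (length z + 2) ∸ a ≡ suc (suc (length z ∸ a))
  index = trans (+-∸-comm 2 a≤z) (+-comm (length z ∸ a) 2)
  in-range : suc (length z ∸ a) ≤ length (tilde (b ∷ z))
  in-range = subst (suc (length z ∸ a) ≤_) (sym (length-tilde (b ∷ z))) (s≤s (m∸n≤m (length z) a))

flip-shifted : ∀ T z a → 1 ≤ a → flipAt ((length T + 2) + a) (false ∷ T ++ true ∷ z) ≡ false ∷ T ++ true ∷ flipAt a z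
flip-shifted T z (suc a) _ =
  trans (cong (λ k → flipAt k (false ∷ T ++ true ∷ z)) index)
        (flip-++ʳ (false ∷ T) (true ∷ z) (suc a))
  where
  index : (length T + 2) + suc a ≡ suc (length T + suc (suc a))
  index = trans (+-assoc (length T) 2 (suc a)) (+-suc (length T) (suc (suc a)))

flip-first : ∀ u v → flipAt (length u + 2) (true ∷ u ++ false ∷ v) ≡ true ∷ u ++ true ∷ v
flip-first u v = trans (cong (λ k → flipAt k (true ∷ u ++ false ∷ v)) (+-comm (length u) 2))
                       (cong (true ∷_) (flip-middle u false v))

-- The path P(1u0v) in four segments: the step 1u0v → 1u1v, the image of P(ũ) under
-- z ↦ 1z̃1v, the step flipping bit 1, and the image of P(v) under z ↦ 0T1z,
-- where T is the reversal-complement of the last vertex of P(ũ).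
module NodePath {u v : Bits} (du : Dyck u) (dv : Dyck v) where
  y : Bits
  y = true ∷ u ++ false ∷ v
  c : ℕ
  c = length u + 2
  ũ : Bits
  ũ = tilde u
  T : Bits
  T = tilde (endpoint ũ (π ũ))
  left : Bits → Bits
  left z = true ∷ tilde z ++ true ∷ v
  right : Bits → Bits
  right z = false ∷ T ++ true ∷ z

  length-T : length T ≡ length u
  length-T = trans (length-tilde (endpoint ũ (π ũ))) (trans (endpoint-length ũ (π ũ)) (length-tilde u))

  -- The reflected flips c − π(ũ) act on the middle of 1z̃1v, the shifted flips c + π(v) on the end of 0T1z.
  transports-left : All (Transports left (c ∸_) (length u)) (π ũ)
  transports-left = All.map (λ { {a} (1≤a , a≤) z lz →
      subst (λ k → flipAt ((k + 2) ∸ a) (left z) ≡ left (flipAt a z)) lz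
            (flip-reflected z a (true ∷ v) 1≤a (subst (a ≤_) (trans (length-tilde u) (sym lz)) a≤)) })
    (π-range (dyck-tilde du))

  transports-right : All (Transports right (c +_) (length v)) (π v)
  transports-right = All.map (λ { {a} (1≤a , _) z _ →
      subst (λ k → flipAt ((k + 2) + a) (right z) ≡ right (flipAt a z)) length-T (flip-shifted T z a 1≤a) })
    (π-range dv)

  second : true ∷ u ++ true ∷ v ≡ left ũ
  second = cong (λ q → true ∷ q ++ true ∷ v) (sym (tilde-involutive u))

  Rest : List Edge
  Rest = map (emap left) (pathEdges ũ) ++ ((left (endpoint ũ (π ũ)) , right v) ∷ map (emap right) (pathEdges v))

  rest-edges : consec (walk (left ũ) (map (c ∸_) (π ũ) ++ 1 ∷ map (c +_) (π v))) ≡ Rest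
  rest-edges = begin
    consec (walk (left ũ) (A ++ 1 ∷ B))
      ≡⟨ consec-walk-++ (left ũ) A (1 ∷ B) ⟩
    consec (walk (left ũ) A) ++ consec (walk (endpoint (left ũ) A) (1 ∷ B))
      ≡⟨ cong₂ (λ p q → consec p ++ consec (walk q (1 ∷ B)))
               (walk-map left (c ∸_) (length u) (π ũ) ũ (length-tilde u) transports-left)
               (endpoint-map left (c ∸_) (length u) (π ũ) ũ (length-tilde u) transports-left) ⟩
    consec (map left (walk ũ (π ũ))) ++ consec (left (endpoint ũ (π ũ)) ∷ walk (right v) B)
      ≡⟨ cong₂ _++_ (consec-map left (walk ũ (π ũ))) (consec-cons (left (endpoint ũ (π ũ))) (right v) B) ⟩
    map (emap left) (pathEdges ũ) ++ ((left (endpoint ũ (π ũ)) , right v) ∷ consec (walk (right v) B))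
      ≡⟨ cong (λ p → map (emap left) (pathEdges ũ) ++ ((left (endpoint ũ (π ũ)) , right v) ∷ consec p))
              (walk-map right (c +_) (length v) (π v) v refl transports-right) ⟩
    map (emap left) (pathEdges ũ) ++ ((left (endpoint ũ (π ũ)) , right v) ∷ consec (map right (walk v (π v))))
      ≡⟨ cong (λ p → map (emap left) (pathEdges ũ) ++ ((left (endpoint ũ (π ũ)) , right v) ∷ p))
              (consec-map right (walk v (π v))) ⟩
    Rest ∎
    where
    open ≡-Reasoning
    A : List ℕ
    A = map (c ∸_) (π ũ)
    B : List ℕ
    B = map (c +_) (π v)

  pathEdges-node : pathEdges y ≡ (y , true ∷ u ++ true ∷ v) ∷ Rest
  pathEdges-node = begin
    consec (walk y (π y))
      ≡⟨ cong (λ p → consec (walk y p)) (π-node du dv) ⟩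
    consec (y ∷ walk (flipAt c y) rest)
      ≡⟨ consec-cons y (flipAt c y) rest ⟩
    (y , flipAt c y) ∷ consec (walk (flipAt c y) rest)
      ≡⟨ cong (λ q → (y , q) ∷ consec (walk q rest)) (trans (flip-first u v) second) ⟩
    (y , left ũ) ∷ consec (walk (left ũ) rest)
      ≡⟨ cong₂ (λ q r → (y , q) ∷ r) (sym second) rest-edges ⟩
    (y , true ∷ u ++ true ∷ v) ∷ Rest ∎
    where
    open ≡-Reasoning
    rest : List ℕ
    rest = map (c ∸_) (π ũ) ++ 1 ∷ map (c +_) (π v)

  data NodeEdge (a b : Bits) : Set where
    first-step : a ≡ y → b ≡ true ∷ u ++ true ∷ v → NodeEdge a b
    left-step  : ∀ z₁ z₂ → (z₁ , z₂) ∈ pathEdges ũ → a ≡ left z₁ → b ≡ left z₂ → NodeEdge a b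
    middle-step : a ≡ left (endpoint ũ (π ũ)) → b ≡ right v → NodeEdge a b
    right-step : ∀ z₁ z₂ → (z₁ , z₂) ∈ pathEdges v → a ≡ right z₁ → b ≡ right z₂ → NodeEdge a b

  classify : ∀ {a b} → (a , b) ∈ pathEdges y → NodeEdge a b
  classify m rewrite pathEdges-node with m
  ... | here refl = first-step refl refl
  ... | there m' with ∈-++⁻ (map (emap left) (pathEdges ũ)) m'
  ... | inj₁ m-left with ∈-map⁻ (emap left) m-left
  ...   | (z₁ , z₂) , mz , refl = left-step z₁ z₂ mz refl refl
  classify m | there m' | inj₂ (here refl) = middle-step refl refl
  classify m | there m' | inj₂ (there m-right) with ∈-map⁻ (emap right) m-right
  ...   | (z₁ , z₂) , mz , refl = right-step z₁ z₂ mz refl refl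

pathEdges-++ : ∀ {x r} → Dyck x → Dyck r →
  pathEdges (x ++ r) ≡ map (emap (_++ r)) (pathEdges x) ++ map (emap (endpoint x (π x) ++_)) (pathEdges r)
pathEdges-++ {x} {r} dx dr = begin
  consec (walk (x ++ r) (π (x ++ r)))
    ≡⟨ cong (λ p → consec (walk (x ++ r) p)) (π-++ dx dr) ⟩
  consec (walk (x ++ r) (π x ++ B))
    ≡⟨ consec-walk-++ (x ++ r) (π x) B ⟩
  consec (walk (x ++ r) (π x)) ++ consec (walk (endpoint (x ++ r) (π x)) B)
    ≡⟨ cong₂ (λ p q → consec (walk (x ++ r) p) ++ consec (walk (endpoint (x ++ r) q) B))
             (sym (map-id (π x))) (sym (map-id (π x))) ⟩
  consec (walk (x ++ r) (map id (π x))) ++ consec (walk (endpoint (x ++ r) (map id (π x))) B)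
    ≡⟨ cong₂ (λ p q → consec p ++ consec (walk q B))
             (walk-map (_++ r) id (length x) (π x) x refl on-left)
             (endpoint-map (_++ r) id (length x) (π x) x refl on-left) ⟩
  consec (map (_++ r) (walk x (π x))) ++ consec (walk (E ++ r) B)
    ≡⟨ cong₂ (λ p q → p ++ consec q) (consec-map (_++ r) (walk x (π x)))
             (walk-map (E ++_) (length x +_) (length r) (π r) r refl on-right) ⟩
  map (emap (_++ r)) (pathEdges x) ++ consec (map (E ++_) (walk r (π r)))
    ≡⟨ cong (map (emap (_++ r)) (pathEdges x) ++_) (consec-map (E ++_) (walk r (π r))) ⟩
  map (emap (_++ r)) (pathEdges x) ++ map (emap (E ++_)) (pathEdges r) ∎
  where
  open ≡-Reasoning
  E : Bits
  E = endpoint x (π x)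
  B : List ℕ
  B = map (length x +_) (π r)
  on-left : All (Transports (_++ r) id (length x)) (π x)
  on-left = All.map (λ { {a} (_ , a≤) z lz → flip-++ˡ a z r (subst (a ≤_) (sym lz) a≤) }) (π-range dx)
  on-right : All (Transports (E ++_) (length x +_) (length r)) (π r)
  on-right = All.map (λ { {suc a} _ z _ →
      subst (λ k → flipAt (k + suc a) (E ++ z) ≡ E ++ flipAt (suc a) z) (endpoint-length x (π x)) (flip-++ʳ E z a) })
    (π-range dr)

length-++-≡ : ∀ (X Y Z W : Bits) → X ++ Y ≡ Z ++ W → length X + length Y ≡ length Z + length W
length-++-≡ X Y Z W eq = trans (sym (length-++ X)) (trans (cong length eq) (length-++ Z))

equidivisible : ∀ (X Y Z W : Bits) → X ++ Y ≡ Z ++ W → length Z ≤ length X →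
                Σ Bits λ m → (X ≡ Z ++ m) × (W ≡ m ++ Y)
equidivisible X Y [] W eq _ = X , refl , sym eq
equidivisible (x ∷ X) Y (z ∷ Z) W eq (s≤s l) with ∷-injective eq
... | refl , eq' with equidivisible X Y Z W eq' l
... | m , X≡ , W≡ = m , cong (x ∷_) X≡ , W≡

equidivisibleʳ : ∀ (X Y Z W : Bits) → X ++ Y ≡ Z ++ W → length Y ≤ length W →
                 Σ Bits λ m → (X ≡ Z ++ m) × (W ≡ m ++ Y)
equidivisibleʳ X Y Z W eq l = equidivisible X Y Z W eq Z≤X
  where
  Z≤X : length Z ≤ length X
  Z≤X = +-cancelʳ-≤ (length Y) (length Z) (length X)
          (subst (length Z + length Y ≤_) (sym (length-++-≡ X Y Z W eq)) (+-monoʳ-≤ (length Z) l))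

++-cancel-lengthˡ : ∀ (X Y Z W : Bits) → X ++ Y ≡ Z ++ W → length X ≡ length Z → (X ≡ Z) × (Y ≡ W)
++-cancel-lengthˡ [] Y [] W eq _ = refl , eq
++-cancel-lengthˡ (x ∷ X) Y (z ∷ Z) W eq l with ∷-injective eq
... | refl , eq' with ++-cancel-lengthˡ X Y Z W eq' (suc-injective l)
... | refl , refl = refl , refl

++-cancel-lengthʳ : ∀ (X Y Z W : Bits) → X ++ Y ≡ Z ++ W → length Y ≡ length W → (X ≡ Z) × (Y ≡ W)
++-cancel-lengthʳ X Y Z W eq l =
  ++-cancel-lengthˡ X Y Z W eq (+-cancelʳ-≡ (length Y) (length X) (length Z)
                                  (trans (length-++-≡ X Y Z W eq) (cong (length Z +_) (sym l))))

regroup : ∀ (b : Bool) W (c : Bool) z → b ∷ W ++ c ∷ z ≡ (b ∷ W ++ c ∷ []) ++ z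
regroup b W c z = cong (b ∷_) (sym (++-assoc W (c ∷ []) z))

-- If p r = 1W1v with Dyck words r and v, then r is a suffix of v (it cannot be a
-- suffix of 1v), hence 1u0v = x'r for some x'.
suffix-beyond-1 : ∀ {r v} u W p → Dyck r → Dyck v → p ++ r ≡ true ∷ W ++ true ∷ v →
                  Σ Bits λ x' → true ∷ u ++ false ∷ v ≡ x' ++ r
suffix-beyond-1 {r} {v} u W p dr dv eq with length r ≤? length v
... | yes r≤v with equidivisibleʳ p r (true ∷ W ++ true ∷ []) v (trans eq (regroup true W true v)) r≤v
...   | m , _ , v≡ = (true ∷ u ++ false ∷ m) , (begin
        true ∷ u ++ false ∷ v       ≡⟨ cong (λ q → true ∷ u ++ false ∷ q) v≡ ⟩
        true ∷ u ++ false ∷ m ++ r  ≡⟨ cong (true ∷_) (sym (++-assoc u (false ∷ m) r)) ⟩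
        (true ∷ u ++ false ∷ m) ++ r ∎)
  where open ≡-Reasoning
suffix-beyond-1 {r} {v} u W p dr dv eq | no r≰v with equidivisibleʳ (true ∷ W) (true ∷ v) p r (sym eq) (≰⇒> r≰v)
... | q , _ , r≡ = ⊥-elim (dyck-not-ending-1dyck q dr dv r≡)

common-suffix : ∀ R {z₁ z₂ p₁ p₂ r : Bits} → p₁ ++ r ≡ R ++ z₁ → p₂ ++ r ≡ R ++ z₂ →
                length z₁ ≡ length z₂ → z₁ ≢ z₂ →
                Σ Bits λ m₁ → Σ Bits λ m₂ → (z₁ ≡ m₁ ++ r) × (z₂ ≡ m₂ ++ r)
common-suffix R {z₁} {z₂} {p₁} {p₂} {r} eq₁ eq₂ lz z₁≢z₂ with length r ≤? length z₁
... | yes r≤z with equidivisibleʳ p₁ r R z₁ eq₁ r≤z | equidivisibleʳ p₂ r R z₂ eq₂ (subst (length r ≤_) lz r≤z)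
...   | m₁ , _ , z₁≡ | m₂ , _ , z₂≡ = m₁ , m₂ , z₁≡ , z₂≡
common-suffix R {z₁} {z₂} {p₁} {p₂} {r} eq₁ eq₂ lz z₁≢z₂ | no r≰z
  with equidivisibleʳ R z₁ p₁ r (sym eq₁) (<⇒≤ (≰⇒> r≰z))
     | equidivisibleʳ R z₂ p₂ r (sym eq₂) (subst (_≤ length r) lz (<⇒≤ (≰⇒> r≰z)))
... | q₁ , _ , r≡₁ | q₂ , _ , r≡₂ = ⊥-elim (z₁≢z₂ (proj₂ (++-cancel-lengthʳ q₁ z₁ q₂ z₂ (trans (sym r≡₁) r≡₂) lz)))

word-suffix : ∀ {x r} → Dyck x → Dyck r → ∀ {a b} p₁ p₂ → (a , b) ∈ pathEdges x →
              a ≡ p₁ ++ r → b ≡ p₂ ++ r → Σ Bits λ x' → x ≡ x' ++ r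
word-suffix empty dr p₁ p₂ () _ _
word-suffix {r = r} (node {u} {v} du dv) dr {a} {b} p₁ p₂ m a≡ b≡ with NodePath.classify du dv m
... | NodePath.first-step a≡y _ = p₁ , trans (sym a≡y) a≡
... | NodePath.left-step z₁ _ _ a≡left _ = suffix-beyond-1 u (tilde z₁) p₁ dr dv (trans (sym a≡) a≡left)
... | NodePath.middle-step a≡left _ = suffix-beyond-1 u (NodePath.T du dv) p₁ dr dv (trans (sym a≡) a≡left)
... | NodePath.right-step z₁ z₂ mz a≡right b≡right
  with common-suffix (false ∷ NodePath.T du dv ++ true ∷ [])
         (trans (sym a≡) (trans a≡right (regroup false (NodePath.T du dv) true z₁)))
         (trans (sym b≡) (trans b≡right (regroup false (NodePath.T du dv) true z₂)))
         (trans (proj₁ (pathEdge-length mz)) (sym (proj₂ (pathEdge-length mz)))) (pathEdge-proper dv mz)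
... | m₁ , m₂ , z₁≡ , z₂≡ with word-suffix dv dr m₁ m₂ mz z₁≡ z₂≡
... | v' , v≡ = (true ∷ u ++ false ∷ v') , (begin
  true ∷ u ++ false ∷ v        ≡⟨ cong (λ q → true ∷ u ++ false ∷ q) v≡ ⟩
  true ∷ u ++ false ∷ v' ++ r  ≡⟨ cong (true ∷_) (sym (++-assoc u (false ∷ v') r)) ⟩
  (true ∷ u ++ false ∷ v') ++ r ∎)
  where open ≡-Reasoning

edge-suffix : ∀ {x r p₁ p₂} → Dyck x → Dyck r → (p₁ ++ r , p₂ ++ r) ∈ pathEdges x →
              Σ Bits λ x' → Dyck x' × (x ≡ x' ++ r) × ((p₁ , p₂) ∈ pathEdges x')
edge-suffix {x} {r} {p₁} {p₂} dx dr m with word-suffix dx dr p₁ p₂ m refl refl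
... | x' , refl with ∈-++⁻ (map (emap (_++ r)) (pathEdges x')) (subst ((p₁ ++ r , p₂ ++ r) ∈_) (pathEdges-++ dx' dr) m)
  where dx' = dyck-prefix x' dx dr
... | inj₁ m-left with ∈-map⁻ (emap (_++ r)) m-left
...   | (a' , b') , m' , eq = x' , dyck-prefix x' dx dr , refl ,
        subst₂ (λ a b → (a , b) ∈ pathEdges x') (++-cancelʳ r a' p₁ (sym (cong proj₁ eq))) (++-cancelʳ r b' p₂ (sym (cong proj₂ eq))) m'
edge-suffix {x} {r} {p₁} {p₂} dx dr m | x' , refl | inj₂ m-right with ∈-map⁻ (emap (endpoint x' (π x') ++_)) m-right
...   | (t₁ , t₂) , mt , eq = ⊥-elim (pathEdge-proper dx m (trans (cong proj₁ eq) (trans (cong (E ++_) t₁≡t₂) (sym (cong proj₂ eq)))))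
  where
  E : Bits
  E = endpoint x' (π x')
  t≡r : ∀ {p t} → p ++ r ≡ E ++ t → length t ≡ length r → t ≡ r
  t≡r {p} {t} eq' lt = sym (proj₂ (++-cancel-lengthʳ p r E t eq' (sym lt)))
  t₁≡t₂ : t₁ ≡ t₂
  t₁≡t₂ = trans (t≡r (cong proj₁ eq) (proj₁ (pathEdge-length mt))) (sym (t≡r (cong proj₂ eq) (proj₂ (pathEdge-length mt))))

_≟b_ : DecidableEquality Bits
_≟b_ = ≡-dec Bool._≟_

open import Data.List.Relation.Unary.Unique.DecPropositional _≟b_ using (unique?)
open import Data.List.Membership.DecPropositional _≟b_ using (_∈?_)

_≟e_ : DecidableEquality Edge
_≟e_ = ×-≡-dec _≟b_ _≟b_

open import Data.List.Membership.DecPropositional _≟e_ using () renaming (_∈?_ to _∈e?_)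
open import Data.List.Membership.DecPropositional _≟_ using () renaming (_∈?_ to _∈ℕ?_)

sameEdge? : ∀ f g → Dec (SameEdge f g)
sameEdge? (a , b) (c , d) = ((a ≟b c) ×-dec (b ≟b d)) ⊎-dec ((a ≟b d) ×-dec (b ≟b c))

sameEdge-sym : ∀ {f g} → SameEdge f g → SameEdge g f
sameEdge-sym {a , b} {c , d} (inj₁ (refl , refl)) = inj₁ (refl , refl)
sameEdge-sym {a , b} {c , d} (inj₂ (refl , refl)) = inj₂ (refl , refl)

sameEdge-trans : ∀ {f g h} → SameEdge f g → SameEdge g h → SameEdge f h
sameEdge-trans {a , b} {c , d} (inj₁ (refl , refl)) q = q
sameEdge-trans {a , b} {c , d} {_ , _} (inj₂ (refl , refl)) (inj₁ (refl , refl)) = inj₂ (refl , refl)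
sameEdge-trans {a , b} {c , d} {_ , _} (inj₂ (refl , refl)) (inj₂ (refl , refl)) = inj₁ (refl , refl)

sameEdge-map : ∀ (h : Bits → Bits) {f g} → SameEdge f g → SameEdge (emap h f) (emap h g)
sameEdge-map h (inj₁ (refl , refl)) = inj₁ (refl , refl)
sameEdge-map h (inj₂ (refl , refl)) = inj₂ (refl , refl)

adjacent? : ∀ a b → Dec (Adjacent a b)
adjacent? a b = (length a ≟ length b) ×-dec (hamming a b ≟ 1)

allBits : ℕ → List Bits
allBits zero = [] ∷ []
allBits (suc n) = map (true ∷_) (allBits n) ++ map (false ∷_) (allBits n)

∈-allBits : ∀ x → x ∈ allBits (length x)
∈-allBits [] = here refl
∈-allBits (true ∷ x) = ∈-++⁺ˡ (∈-map⁺ (true ∷_) (∈-allBits x))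
∈-allBits (false ∷ x) = ∈-++⁺ʳ (map (true ∷_) (allBits (length x))) (∈-map⁺ (false ∷_) (∈-allBits x))

-- A concrete flippable tuple can be verified by evaluation: `Certificate k τ C es`
-- restates `Flippable k τ` for a given cycle C and edge list es with every clause
-- decidable (Dyck words instead of the prefix condition, and all Dyck words of
-- length 2k enumerated).
module _ (k : ℕ) (τ : MarkedTuple) (C : List Bits) where
  WellMarked : Bits × ℕ → Set
  WellMarked (x , m) = Dyck x × (length x ≡ 2 * k) × (1 ≤ m) × (m ≤ 2 * k)

  OnlyShared : Bits → Edge → Set
  OnlyShared x f = All (λ h₁ → All (λ h₂ → SameEdge h₁ h₂ → SameEdge h₁ f) (pathEdges x)) (cycleEdges C)

  Avoided : Bits → Set
  Avoided y = Dyck y → y ∉ map proj₁ τ → All (λ h₁ → All (λ h₂ → ¬ SameEdge h₁ h₂) (pathEdges y)) (cycleEdges C)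

  Certificate : List Edge → Set
  Certificate es =
    (3 ≤ length τ) × All WellMarked τ × Unique (map proj₁ τ) × IsCycle k C × (length C ≡ 2 * length τ) ×
    Pointwise (λ xm f → e (proj₁ xm) (proj₂ xm) ≡ just f) τ es ×
    AllPairs (λ f g → ¬ SameEdge f g) es ×
    Pointwise (λ xm f → (f ∈E cycleEdges C) × OnlyShared (proj₁ xm) f) τ es ×
    All Avoided (allBits (2 * k))

  certificate? : ∀ es → Dec (Certificate es)
  certificate? es =
    (3 ≤? length τ) ×-dec all? wellMarked? τ ×-dec unique? (map proj₁ τ) ×-dec
    ((3 ≤? length C) ×-dec all? inB? C ×-dec unique? C ×-dec all? (λ f → adjacent? (proj₁ f) (proj₂ f)) (cycleEdges C)) ×-dec
    (length C ≟ 2 * length τ) ×-dec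
    Pointwise.decidable (λ xm f → ≡-dec-maybe (e (proj₁ xm) (proj₂ xm)) (just f)) τ es ×-dec
    allPairs? (λ f g → ¬? (sameEdge? f g)) es ×-dec
    Pointwise.decidable (λ xm f → any? (sameEdge? f) (cycleEdges C) ×-dec onlyShared? (proj₁ xm) f) τ es ×-dec
    all? avoided? (allBits (2 * k))
    where
    ≡-dec-maybe : DecidableEquality (Maybe Edge)
    ≡-dec-maybe = Maybe.≡-dec _≟e_
    wellMarked? : ∀ xm → Dec (WellMarked xm)
    wellMarked? (x , m) = dyck? x ×-dec (length x ≟ 2 * k) ×-dec (1 ≤? m) ×-dec (m ≤? 2 * k)
    inB? : ∀ x → Dec (InB k x)
    inB? x = (length x ≟ 2 * k) ×-dec ((ones x ≟ k) ⊎-dec (ones x ≟ suc k))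
    onlyShared? : ∀ x f → Dec (OnlyShared x f)
    onlyShared? x f = all? (λ h₁ → all? (λ h₂ → sameEdge? h₁ h₂ →-dec sameEdge? h₁ f) (pathEdges x)) (cycleEdges C)
    avoided? : ∀ y → Dec (Avoided y)
    avoided? y = dyck? y →-dec ¬? (y ∈? map proj₁ τ) →-dec
                 all? (λ h₁ → all? (λ h₂ → ¬? (sameEdge? h₁ h₂)) (pathEdges y)) (cycleEdges C)

  -- Soundness of the decidable clauses, which compare edges only in the lists at hand.
  onlyShared-sound : ∀ {x f} → OnlyShared x f → ∀ g → g ∈E cycleEdges C → g ∈E pathEdges x → SameEdge g f
  onlyShared-sound only g g∈C g∈P with find g∈C | find g∈P
  ... | h₁ , h₁∈ , g~h₁ | h₂ , h₂∈ , g~h₂ =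
    sameEdge-trans g~h₁ (lookup (lookup only h₁∈) h₂∈ (sameEdge-trans (sameEdge-sym g~h₁) g~h₂))

  avoided-sound : All Avoided (allBits (2 * k)) →
                  ∀ y → InD k y → y ∉ map proj₁ τ → ∀ g → g ∈E cycleEdges C → ¬ (g ∈E pathEdges y)
  avoided-sound avoided y y∈D y∉τ g g∈C g∈P with find g∈C | find g∈P
  ... | h₁ , h₁∈ , g~h₁ | h₂ , h₂∈ , g~h₂ =
    lookup (lookup (lookup avoided y∈all (InD→Dyck y∈D) y∉τ) h₁∈) h₂∈ (sameEdge-trans (sameEdge-sym g~h₁) g~h₂)
    where
    y∈all : y ∈ allBits (2 * k)
    y∈all = subst (λ n → y ∈ allBits n) (proj₁ y∈D) (∈-allBits y)

  certificate-sound : ∀ es → Certificate es → Flippable k τ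
  certificate-sound es (3≤τ , marked , distinct , cycle , length-C , edges , edges-distinct , shared , avoided) =
    3≤τ ,
    All.map (λ { (dx , len , 1≤m , m≤) → Dyck→InD dx len , 1≤m , m≤ }) marked ,
    distinct , C , cycle , length-C , es , edges , edges-distinct ,
    Pointwise.map (λ { (f∈C , only) → f∈C , onlyShared-sound only }) shared ,
    avoided-sound avoided

flippable-by-evaluation : ∀ k τ C es → True (certificate? k τ C es) → Flippable k τ
flippable-by-evaluation k τ C es ok = certificate-sound k τ C es (toWitness ok)

-- The α family.  For a Dyck word w write hw s = 1ws.  The flipping hexagon is hw
-- applied to the six 5-bit suffixes below, and the tuple words are hw t₁, hw t₂, hw t₃.

s00101 s00111 s00110 s10110 s10100 s10101 : Bits
s00101 = O ∷ O ∷ I ∷ O ∷ I ∷ []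
s00111 = O ∷ O ∷ I ∷ I ∷ I ∷ []
s00110 = O ∷ O ∷ I ∷ I ∷ O ∷ []
s10110 = I ∷ O ∷ I ∷ I ∷ O ∷ []
s10100 = I ∷ O ∷ I ∷ O ∷ O ∷ []
s10101 = I ∷ O ∷ I ∷ O ∷ I ∷ []

hexagon : List Bits
hexagon = s00101 ∷ s00111 ∷ s00110 ∷ s10110 ∷ s10100 ∷ s10101 ∷ []

t₁ t₂ t₃ : Bits
t₁ = I ∷ I ∷ O ∷ O ∷ O ∷ []
t₂ = I ∷ O ∷ I ∷ O ∷ O ∷ []
t₃ = I ∷ O ∷ O ∷ I ∷ O ∷ []

swap : Edge → Edge
swap (a , b) = b , a

hexEdges± : List Edge
hexEdges± = cycleEdges hexagon ++ map swap (cycleEdges hexagon)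

-- The tuple suffixes with the hexagon edge each of their paths should contribute.
answers : List (Bits × Edge)
answers = (t₁ , s00101 , s00111) ∷ (t₂ , s10100 , s10101) ∷ (t₃ , s10110 , s00110) ∷ []

Answered : Bits → Edge → Set
Answered t s = Any (λ a → (t ≡ proj₁ a) × SameEdge s (proj₂ a)) answers

answered? : ∀ t s → Dec (Answered t s)
answered? t s = any? (λ a → (t ≟b proj₁ a) ×-dec sameEdge? s (proj₂ a)) answers

splits : Bits → List (Bits × Bool × Bits)
splits [] = []
splits (b ∷ s) = ([] , b , s) ∷ map (λ { (m , c , v) → (b ∷ m , c , v) }) (splits s)

∈-splits : ∀ m b v → (m , b , v) ∈ splits (m ++ b ∷ v)
∈-splits [] b v = here refl
∈-splits (c ∷ m) b v = there (∈-map⁺ (λ { (m , c' , v) → (c ∷ m , c' , v) }) (∈-splits m b v))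

-- Finite facts about the hexagon, verified by evaluation.  They cover the two ways a
-- path P(1u0v) can contain a hexagon edge (1ws₁, 1ws₂): as its first step, where
-- s₁ = m0v and s₂ = m1v, or inside the image of P(ũ), where s₁ = q₁1v, s₂ = q₂1v and
-- (q̃₁, q̃₂) is an edge of P(x') for a Dyck word x' with ũ = x'w̃.
FirstStepAnswered : Edge → Bits × Bool × Bits → Set
FirstStepAnswered (s₁ , s₂) (m , b , v) =
  b ≡ false → s₂ ≡ m ++ true ∷ v → Dyck m → Dyck v → Answered (m ++ false ∷ v) (s₁ , s₂)

LeftStepAnswered : Edge → Bits × Bool × Bits → Bits × Bool × Bits → Bits → Set
LeftStepAnswered (s₁ , s₂) (q₁ , b₁ , v) (q₂ , b₂ , v₂) x' =
  b₁ ≡ true → b₂ ≡ true → v₂ ≡ v → Dyck v → Dyck x' → (tilde q₁ , tilde q₂) ∈ pathEdges x' →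
  Answered (tilde x' ++ false ∷ v) (s₁ , s₂)

first-step-check : All (λ s → All (FirstStepAnswered s) (splits (proj₁ s))) hexEdges±
first-step-check = from-yes (all? (λ s → all? (decide s) (splits (proj₁ s))) hexEdges±)
  where
  decide : ∀ s sp → Dec (FirstStepAnswered s sp)
  decide (s₁ , s₂) (m , b , v) =
    (b Bool.≟ false) →-dec (s₂ ≟b (m ++ true ∷ v)) →-dec dyck? m →-dec dyck? v →-dec answered? (m ++ false ∷ v) (s₁ , s₂)

left-step-check : All (λ s → All (λ sp₁ → All (λ sp₂ → All (LeftStepAnswered s sp₁ sp₂) (allBits (length (proj₁ sp₁))))
                                              (splits (proj₂ s))) (splits (proj₁ s))) hexEdges±
left-step-check = from-yes (all? (λ s → all? (λ sp₁ → all? (λ sp₂ → all? (decide s sp₁ sp₂) (allBits (length (proj₁ sp₁))))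
                                                     (splits (proj₂ s))) (splits (proj₁ s))) hexEdges±)
  where
  decide : ∀ s sp₁ sp₂ x' → Dec (LeftStepAnswered s sp₁ sp₂ x')
  decide (s₁ , s₂) (q₁ , b₁ , v) (q₂ , b₂ , v₂) x' =
    (b₁ Bool.≟ true) →-dec (b₂ Bool.≟ true) →-dec (v₂ ≟b v) →-dec dyck? v →-dec dyck? x' →-dec
    ((tilde q₁ , tilde q₂) ∈e? pathEdges x') →-dec answered? (tilde x' ++ false ∷ v) (s₁ , s₂)

hexEdges-proper : All (λ s → proj₁ s ≢ proj₂ s) hexEdges±
hexEdges-proper = from-yes (all? (λ s → ¬? (proj₁ s ≟b proj₂ s)) hexEdges±)

answers-functional : All (λ a → All (λ b → proj₁ a ≡ proj₁ b → proj₂ a ≡ proj₂ b) answers) answers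
answers-functional = from-yes (all? (λ a → all? (λ b → (proj₁ a ≟b proj₁ b) →-dec (proj₂ a ≟e proj₂ b)) answers) answers)

no-common-prefix : ∀ b m {v v' s₁ s₂ : Bits} → false ∷ v ≡ (b ∷ m) ++ s₁ → true ∷ v' ≡ (b ∷ m) ++ s₂ → ⊥
no-common-prefix b m e₁ e₂ with trans (∷-injectiveˡ e₁) (sym (∷-injectiveˡ e₂))
... | ()

Located : Bits → Bits → Edge → Set
Located w y s = Σ Bits λ t → (y ≡ true ∷ w ++ t) × Answered t s

first-step-case : ∀ {w u v s₁ s₂} → Dyck w → Dyck u → Dyck v → (s₁ , s₂) ∈ hexEdges± →
                  w ++ s₁ ≡ u ++ false ∷ v → w ++ s₂ ≡ u ++ true ∷ v → Located w (true ∷ u ++ false ∷ v) (s₁ , s₂)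
first-step-case {w} {u} {v} {s₁} {s₂} dw du dv s∈ eq₁ eq₂ with length w ≤? length u
... | yes w≤u with equidivisible u (false ∷ v) w s₁ (sym eq₁) w≤u
...   | m , u≡ , s₁≡ = m ++ false ∷ v , y≡ , answered
  where
  s₂≡ : s₂ ≡ m ++ true ∷ v
  s₂≡ = ++-cancelˡ w s₂ (m ++ true ∷ v) (trans eq₂ (trans (cong (_++ true ∷ v) u≡) (++-assoc w m (true ∷ v))))
  y≡ : true ∷ u ++ false ∷ v ≡ true ∷ w ++ m ++ false ∷ v
  y≡ = cong (true ∷_) (trans (cong (_++ false ∷ v) u≡) (++-assoc w m (false ∷ v)))
  split∈ : (m , false , v) ∈ splits s₁
  split∈ = subst (λ s → (m , false , v) ∈ splits s) (sym s₁≡) (∈-splits m false v)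
  answered : Answered (m ++ false ∷ v) (s₁ , s₂)
  answered = lookup (lookup first-step-check s∈) split∈ refl s₂≡ (dyck-suffix w dw (subst Dyck u≡ du)) dv
first-step-case {w} {u} {v} {s₁} {s₂} dw du dv s∈ eq₁ eq₂ | no w≰u
  with equidivisible w s₁ u (false ∷ v) eq₁ (<⇒≤ (≰⇒> w≰u)) | equidivisible w s₂ u (true ∷ v) eq₂ (<⇒≤ (≰⇒> w≰u))
... | [] , w≡₁ , _ | _ = ⊥-elim (<-irrefl (cong length (sym (trans w≡₁ (++-identityʳ u)))) (≰⇒> w≰u))
... | b ∷ m , w≡₁ , v≡₁ | m₂ , w≡₂ , v≡₂ =
  ⊥-elim (no-common-prefix b m v≡₁ (trans v≡₂ (cong (_++ s₂) (++-cancelˡ u m₂ (b ∷ m) (trans (sym w≡₂) w≡₁)))))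

left-step-case : ∀ {w u v z₁ z₂ s₁ s₂} → Dyck w → Dyck u → Dyck v → (s₁ , s₂) ∈ hexEdges± →
                 (z₁ , z₂) ∈ pathEdges (tilde u) → w ++ s₁ ≡ tilde z₁ ++ true ∷ v → w ++ s₂ ≡ tilde z₂ ++ true ∷ v →
                 Located w (true ∷ u ++ false ∷ v) (s₁ , s₂)
left-step-case {w} {u} {v} {z₁} {z₂} {s₁} {s₂} dw du dv s∈ z∈ eq₁ eq₂ with length w ≤? length (tilde z₁)
... | no w≰z with equidivisible w s₁ (tilde z₁) (true ∷ v) eq₁ (<⇒≤ (≰⇒> w≰z))
                | equidivisible w s₂ (tilde z₂) (true ∷ v) eq₂ (subst (_≤ length w) (pathEdge-tilde-lengths z∈) (<⇒≤ (≰⇒> w≰z)))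
... | m₁ , w≡₁ , v≡₁ | m₂ , w≡₂ , v≡₂ =
  ⊥-elim (lookup hexEdges-proper s∈ (++-cancelˡ m₁ s₁ s₂ (trans (sym v≡₁) (trans v≡₂ (cong (_++ s₂) m₂≡m₁)))))
  where
  m₂≡m₁ : m₂ ≡ m₁
  m₂≡m₁ = sym (proj₂ (++-cancel-lengthˡ (tilde z₁) m₁ (tilde z₂) m₂ (trans (sym w≡₁) w≡₂) (pathEdge-tilde-lengths z∈)))
left-step-case {w} {u} {v} {z₁} {z₂} {s₁} {s₂} dw du dv s∈ z∈ eq₁ eq₂ | yes w≤z
  with equidivisible (tilde z₁) (true ∷ v) w s₁ (sym eq₁) w≤z
     | equidivisible (tilde z₂) (true ∷ v) w s₂ (sym eq₂) (subst (length w ≤_) (pathEdge-tilde-lengths z∈) w≤z)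
... | q₁ , z₁≡ , s₁≡ | q₂ , z₂≡ , s₂≡
  with edge-suffix (dyck-tilde du) (dyck-tilde dw)
         (subst₂ (λ a b → (a , b) ∈ pathEdges (tilde u)) (tilde-solve w q₁ z₁≡) (tilde-solve w q₂ z₂≡) z∈)
... | x' , dx' , ũ≡ , q∈ = tilde x' ++ false ∷ v , y≡ , answered
  where
  u≡ : u ≡ w ++ tilde x'
  u≡ = trans (tilde-solve x' (tilde w) ũ≡) (cong (_++ tilde x') (tilde-involutive w))
  y≡ : true ∷ u ++ false ∷ v ≡ true ∷ w ++ tilde x' ++ false ∷ v
  y≡ = cong (true ∷_) (trans (cong (_++ false ∷ v) u≡) (++-assoc w (tilde x') (false ∷ v)))
  split∈ : ∀ {s q} → s ≡ q ++ true ∷ v → (q , true , v) ∈ splits s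
  split∈ {q = q} s≡ = subst (λ s → (q , true , v) ∈ splits s) (sym s≡) (∈-splits q true v)
  x'∈ : x' ∈ allBits (length q₁)
  x'∈ = subst (λ n → x' ∈ allBits n) (trans (sym (proj₁ (pathEdge-length q∈))) (length-tilde q₁)) (∈-allBits x')
  answered : Answered (tilde x' ++ false ∷ v) (s₁ , s₂)
  answered = lookup (lookup (lookup (lookup left-step-check s∈) (split∈ s₁≡)) (split∈ s₂≡)) x'∈ refl refl refl dv dx' q∈

-- Middle and right steps of P(1u0v)
-- touch words beginning with 0, so only the first step and left steps remain.
hexagon-edge-on-path : ∀ {w y s₁ s₂} → Dyck w → Dyck y → (true ∷ w ++ s₁ , true ∷ w ++ s₂) ∈ pathEdges y →
                       (s₁ , s₂) ∈ hexEdges± → Located w y (s₁ , s₂)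
hexagon-edge-on-path dw empty () _
hexagon-edge-on-path dw (node du dv) m s∈ with NodePath.classify du dv m
... | NodePath.first-step a≡ b≡ = first-step-case dw du dv s∈ (∷-injectiveʳ a≡) (∷-injectiveʳ b≡)
... | NodePath.left-step _ _ z∈ a≡ b≡ = left-step-case dw du dv s∈ z∈ (∷-injectiveʳ a≡) (∷-injectiveʳ b≡)
... | NodePath.middle-step _ b≡ with ∷-injectiveˡ b≡
...   | ()
hexagon-edge-on-path dw (node du dv) m s∈ | NodePath.right-step _ _ _ a≡ _ with ∷-injectiveˡ a≡
...   | ()

module Alpha {w : Bits} (dw : Dyck w) where
  n : ℕ
  n = length w

  hw : Bits → Bits
  hw s = true ∷ w ++ s

  hw-injective : ∀ {a b} → hw a ≡ hw b → a ≡ b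
  hw-injective eq = ++-cancelˡ w _ _ (∷-injectiveʳ eq)

  C : List Bits
  C = map hw hexagon

  sameEdge-unmap : ∀ {f g} → SameEdge (emap hw f) (emap hw g) → SameEdge f g
  sameEdge-unmap (inj₁ (a≡ , b≡)) = inj₁ (hw-injective a≡ , hw-injective b≡)
  sameEdge-unmap (inj₂ (a≡ , b≡)) = inj₂ (hw-injective a≡ , hw-injective b≡)

  oriented : ∀ {g a b s} → SameEdge g (emap hw s) → SameEdge g (a , b) → s ∈ cycleEdges hexagon →
             Σ Edge λ s' → (s' ∈ hexEdges±) × ((a , b) ≡ emap hw s') × SameEdge g (emap hw s')
  oriented {_ , _} {s = _ , _} (inj₁ (refl , refl)) (inj₁ (refl , refl)) s∈ = _ , ∈-++⁺ˡ s∈ , refl , inj₁ (refl , refl)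
  oriented {_ , _} {s = _ , _} (inj₁ (refl , refl)) (inj₂ (refl , refl)) s∈ =
    _ , ∈-++⁺ʳ (cycleEdges hexagon) (∈-map⁺ swap s∈) , refl , inj₂ (refl , refl)
  oriented {_ , _} {s = _ , _} (inj₂ (refl , refl)) (inj₁ (refl , refl)) s∈ =
    _ , ∈-++⁺ʳ (cycleEdges hexagon) (∈-map⁺ swap s∈) , refl , inj₁ (refl , refl)
  oriented {_ , _} {s = _ , _} (inj₂ (refl , refl)) (inj₂ (refl , refl)) s∈ = _ , ∈-++⁺ˡ s∈ , refl , inj₂ (refl , refl)

  shared-edge : ∀ {y} → Dyck y → ∀ g → g ∈E cycleEdges C → g ∈E pathEdges y →
                Σ (Bits × Edge) λ a → (a ∈ answers) × (y ≡ hw (proj₁ a)) × SameEdge g (emap hw (proj₂ a))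
  shared-edge dy g g∈C g∈P with find g∈C | find g∈P
  ... | h , h∈ , g~h | (a , b) , ab∈ , g~ab with ∈-map⁻ (emap hw) h∈
  ... | s , s∈ , refl with oriented g~h g~ab s∈
  ... | s' , s'∈ , refl , g~s' with hexagon-edge-on-path dw dy ab∈ s'∈
  ... | t , y≡ , answered with find answered
  ... | ans , ans∈ , refl , s'~ = ans , ans∈ , y≡ , sameEdge-trans g~s' (sameEdge-map hw s'~)

  only-answer-edge : ∀ {t s} → Dyck (hw t) → (t , s) ∈ answers →
                     ∀ g → g ∈E cycleEdges C → g ∈E pathEdges (hw t) → SameEdge g (emap hw s)
  only-answer-edge {t} {s} dt ts∈ g g∈C g∈P with shared-edge dt g g∈C g∈P
  ... | (t' , s') , a∈ , hw-t≡ , g~ = subst (λ s'' → SameEdge g (emap hw s'')) (sym s≡s') g~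
    where
    s≡s' : s ≡ s'
    s≡s' = lookup (lookup answers-functional ts∈) a∈ (hw-injective hw-t≡)

  avoided : ∀ {k} y → InD k y → y ∉ map proj₁ (α w) → ∀ g → g ∈E cycleEdges C → ¬ (g ∈E pathEdges y)
  avoided y y∈D y∉ g g∈C g∈P with shared-edge (InD→Dyck y∈D) g g∈C g∈P
  ... | a , a∈ , refl , _ = y∉ (∈-map⁺ (hw ∘ proj₁) a∈)

  dyck-hw : ∀ {t} → HeightPath 1 t 0 → Dyck (hw t)
  dyck-hw p = heightPath→dyck (up (heightPath-++ (dyck→heightPath dw) p))

  adjacent-hw : ∀ {a b} → Adjacent a b → Adjacent (hw a) (hw b)
  adjacent-hw {a} {b} (la , ha) =
    cong suc (trans (length-++ w) (trans (cong (n +_) la) (sym (length-++ w)))) , trans (hamming-++ w a b) ha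

  flip-after-1w : ∀ a z → 1 ≤ a → flipAt (a + suc n) (hw z) ≡ hw (flipAt a z)
  flip-after-1w (suc a) z _ = trans (cong (λ i → flipAt i (hw z)) (+-comm (suc a) (suc n))) (flip-++ʳ (true ∷ w) z a)

  marked-edge : ∀ t pre i rest → π (hw t) ≡ map (_+ suc n) pre ++ (i + suc n) ∷ rest →
                i ∉ pre → 1 ≤ i → All (1 ≤_) pre →
                e (hw t) (i + suc n) ≡ just (emap hw (endpoint t pre , flipAt i (endpoint t pre)))
  marked-edge t pre i rest π≡ i∉ 1≤i pre≥1 = begin
    edgeLookup (consec (walk (hw t) (π (hw t)))) (π (hw t)) (i + suc n)
      ≡⟨ cong (λ p → edgeLookup (consec (walk (hw t) p)) p (i + suc n)) π≡ ⟩
    edgeLookup (consec (walk (hw t) (map shift pre ++ (i + suc n) ∷ rest))) (map shift pre ++ (i + suc n) ∷ rest) (i + suc n)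
      ≡⟨ edgeLookup-walk (hw t) (map shift pre) (i + suc n) rest shifted-∉ ⟩
    just (endpoint (hw t) (map shift pre) , flipAt (i + suc n) (endpoint (hw t) (map shift pre)))
      ≡⟨ cong (λ z → just (z , flipAt (i + suc n) z)) (endpoint-map hw shift (length t) pre t refl transports) ⟩
    just (hw E , flipAt (i + suc n) (hw E))
      ≡⟨ cong (λ z → just (hw E , z)) (flip-after-1w i E 1≤i) ⟩
    just (hw E , hw (flipAt i E)) ∎
    where
    open ≡-Reasoning
    shift : ℕ → ℕ
    shift = _+ suc n
    E : Bits
    E = endpoint t pre
    transports : All (Transports hw shift (length t)) pre
    transports = All.map (λ {a} 1≤a z _ → flip-after-1w a z 1≤a) pre≥1
    shifted-∉ : i + suc n ∉ map shift pre
    shifted-∉ m with ∈-map⁻ shift m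
    ... | a , a∈ , eq = i∉ (subst (_∈ pre) (sym (+-cancelʳ-≡ (suc n) i a eq)) a∈)

  π-hw : ∀ {p v} → Dyck p → Dyck v →
         let c = (length p + 2) + n in
         π (hw (p ++ false ∷ v)) ≡ c ∷ map (c ∸_) (π (tilde p) ++ map (length (tilde p) +_) (π (tilde w))) ++ 1 ∷ map (c +_) (π v)
  π-hw {p} {v} dp dv = begin
    π (true ∷ w ++ p ++ false ∷ v)
      ≡⟨ cong (λ z → π (true ∷ z)) (sym (++-assoc w p (false ∷ v))) ⟩
    π (true ∷ (w ++ p) ++ false ∷ v)
      ≡⟨ π-node (dyck-++ dw dp) dv ⟩
    c' ∷ map (c' ∸_) (π (tilde (w ++ p))) ++ 1 ∷ map (c' +_) (π v)
      ≡⟨ cong (λ k → k ∷ map (k ∸_) (π (tilde (w ++ p))) ++ 1 ∷ map (k +_) (π v)) c'≡c ⟩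
    c ∷ map (c ∸_) (π (tilde (w ++ p))) ++ 1 ∷ map (c +_) (π v)
      ≡⟨ cong (λ q → c ∷ map (c ∸_) q ++ 1 ∷ map (c +_) (π v))
              (trans (cong π (tilde-++ w p)) (π-++ (dyck-tilde dp) (dyck-tilde dw))) ⟩
    c ∷ map (c ∸_) (π (tilde p) ++ map (length (tilde p) +_) (π (tilde w))) ++ 1 ∷ map (c +_) (π v) ∎
    where
    open ≡-Reasoning
    c : ℕ
    c = (length p + 2) + n
    c' : ℕ
    c' = length (w ++ p) + 2
    c'≡c : c' ≡ c
    c'≡c = trans (cong (_+ 2) (length-++ w)) (trans (+-assoc n (length p) 2) (+-comm n (length p + 2)))

  marked₁ : e (hw t₁) (n + 5) ≡ just (emap hw (s00101 , s00111))
  marked₁ = trans (cong (e (hw t₁)) (+-comm n 5))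
    (marked-edge t₁ (5 ∷ 1 ∷ 3 ∷ 2 ∷ []) 4 _ (π-hw (from-yes (dyck? (I ∷ I ∷ O ∷ O ∷ []))) empty)
                 (from-no (4 ∈ℕ? (5 ∷ 1 ∷ 3 ∷ 2 ∷ []))) (s≤s z≤n) (from-yes (all? (1 ≤?_) (5 ∷ 1 ∷ 3 ∷ 2 ∷ []))))

  marked₂ : e (hw t₂) (n + 6) ≡ just (emap hw (s10100 , s10101))
  marked₂ = trans (cong (e (hw t₂)) (+-comm n 6))
    (marked-edge t₂ [] 5 _ (π-hw (from-yes (dyck? (I ∷ O ∷ I ∷ O ∷ []))) empty) (λ ()) (s≤s z≤n) [])

  marked₃ : e (hw t₃) (n + 2) ≡ just (emap hw (s10110 , s00110))
  marked₃ = trans (cong (e (hw t₃)) (+-comm n 2))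
    (marked-edge t₃ (3 ∷ []) 1 _ (π-hw (from-yes (dyck? (I ∷ O ∷ []))) (from-yes (dyck? (I ∷ O ∷ []))))
                 (from-no (1 ∈ℕ? (3 ∷ []))) (s≤s z≤n) (s≤s z≤n ∷ []))

flippable-α : ∀ j w → InD j w → Flippable (j + 3) (α w)
flippable-α j w w∈D@(length-w , ones-w , _) =
  s≤s (s≤s (s≤s z≤n)) ,
  (well-marked 5 dyck₁ refl (s≤s z≤n) (from-yes (5 ≤? 6)) ∷
   well-marked 6 dyck₂ refl (s≤s z≤n) (from-yes (6 ≤? 6)) ∷
   well-marked 2 dyck₃ refl (s≤s z≤n) (from-yes (2 ≤? 6)) ∷ []) ,
  unique-map⁺ hw-injective (from-yes (unique? (t₁ ∷ t₂ ∷ t₃ ∷ []))) ,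
  C , hexagon-cycle , refl , map (emap hw ∘ proj₂) answers ,
  (marked₁ ∷ marked₂ ∷ marked₃ ∷ []) ,
  allPairs-map⁺ (AllPairs.map (_∘ sameEdge-unmap) (from-yes (allPairs? (λ a b → ¬? (sameEdge? (proj₂ a) (proj₂ b))) answers))) ,
  ((here (inj₁ (refl , refl)) , only-answer-edge dyck₁ (here refl)) ∷
   (there (there (there (there (here (inj₁ (refl , refl)))))) , only-answer-edge dyck₂ (there (here refl))) ∷
   (there (there (here (inj₂ (refl , refl)))) , only-answer-edge dyck₃ (there (there (here refl)))) ∷ []) ,
  avoided
  where
  open Alpha (InD→Dyck w∈D)
  K : ℕ
  K = j + 3

  dyck₁ : Dyck (hw t₁)
  dyck₁ = dyck-hw (from-yes (heightPath? 1 t₁))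
  dyck₂ : Dyck (hw t₂)
  dyck₂ = dyck-hw (from-yes (heightPath? 1 t₂))
  dyck₃ : Dyck (hw t₃)
  dyck₃ = dyck-hw (from-yes (heightPath? 1 t₃))

  2K : 2 * K ≡ 2 * j + 6
  2K = *-distribˡ-+ 2 j 3

  length-hw : ∀ s → length s ≡ 5 → length (hw s) ≡ 2 * K
  length-hw s ls = begin
    suc (length (w ++ s))   ≡⟨ cong suc (length-++ w) ⟩
    suc (n + length s)      ≡⟨ cong₂ (λ a b → suc (a + b)) length-w ls ⟩
    suc (2 * j + 5)         ≡⟨ sym (+-suc (2 * j) 5) ⟩
    2 * j + 6               ≡⟨ sym 2K ⟩
    2 * K                   ∎
    where open ≡-Reasoning

  well-marked : ∀ {t} k → Dyck (hw t) → length t ≡ 5 → 1 ≤ k → k ≤ 6 →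
                InD K (hw t) × (1 ≤ n + k) × (n + k ≤ 2 * K)
  well-marked {t} k dt lt 1≤k k≤6 =
    Dyck→InD dt (length-hw t lt) , ≤-trans 1≤k (m≤n+m k n) ,
    subst (n + k ≤_) (trans (cong (_+ 6) length-w) (sym 2K)) (+-monoʳ-≤ n k≤6)

  ones-hw : ∀ s → ones (hw s) ≡ suc (j + ones s)
  ones-hw s = cong suc (trans (ones-++ w s) (cong (_+ ones s) ones-w))

  in-B : ∀ s → length s ≡ 5 → (ones s ≡ 2) ⊎ (ones s ≡ 3) → InB K (hw s)
  in-B s ls (inj₁ o) = length-hw s ls , inj₁ (trans (ones-hw s) (trans (cong (λ m → suc (j + m)) o) (sym (+-suc j 2))))
  in-B s ls (inj₂ o) = length-hw s ls , inj₂ (trans (ones-hw s) (cong (λ m → suc (j + m)) o))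

  hexagon-cycle : IsCycle K C
  hexagon-cycle =
    s≤s (s≤s (s≤s z≤n)) ,
    map⁺ {f = hw} (All.map (λ { {s} (l , o) → in-B s l o })
                  (from-yes (all? (λ s → (length s ≟ 5) ×-dec ((ones s ≟ 2) ⊎-dec (ones s ≟ 3))) hexagon))) ,
    unique-map⁺ hw-injective (from-yes (unique? hexagon)) ,
    map⁺ {f = emap hw} (All.map (λ {f} → adjacent-hw {proj₁ f} {proj₂ f}) (from-yes (all? (λ f → adjacent? (proj₁ f) (proj₂ f)) (cycleEdges hexagon))))

flippable-β : Flippable 3 β
flippable-β = flippable-by-evaluation 3 β
  ((I ∷ I ∷ I ∷ O ∷ O ∷ O ∷ []) ∷ (I ∷ I ∷ I ∷ O ∷ O ∷ I ∷ []) ∷ (O ∷ I ∷ I ∷ O ∷ O ∷ I ∷ []) ∷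
   (O ∷ I ∷ I ∷ O ∷ I ∷ I ∷ []) ∷ (O ∷ I ∷ I ∷ O ∷ I ∷ O ∷ []) ∷ (I ∷ I ∷ I ∷ O ∷ I ∷ O ∷ []) ∷ [])
  ((I ∷ I ∷ I ∷ O ∷ O ∷ O ∷ [] , I ∷ I ∷ I ∷ O ∷ O ∷ I ∷ []) ∷
   (O ∷ I ∷ I ∷ O ∷ O ∷ I ∷ [] , O ∷ I ∷ I ∷ O ∷ I ∷ I ∷ []) ∷
   (I ∷ I ∷ I ∷ O ∷ I ∷ O ∷ [] , O ∷ I ∷ I ∷ O ∷ I ∷ O ∷ []) ∷ [])
  _

flippable-γ : Flippable 4 γ
flippable-γ = flippable-by-evaluation 4 γ
  ((I ∷ O ∷ O ∷ I ∷ I ∷ I ∷ O ∷ O ∷ []) ∷ (I ∷ I ∷ O ∷ I ∷ I ∷ I ∷ O ∷ O ∷ []) ∷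
   (I ∷ I ∷ O ∷ I ∷ I ∷ O ∷ O ∷ O ∷ []) ∷ (I ∷ I ∷ O ∷ I ∷ I ∷ O ∷ O ∷ I ∷ []) ∷
   (I ∷ O ∷ O ∷ I ∷ I ∷ O ∷ O ∷ I ∷ []) ∷ (I ∷ O ∷ O ∷ I ∷ I ∷ I ∷ O ∷ I ∷ []) ∷ [])
  ((I ∷ I ∷ O ∷ I ∷ I ∷ I ∷ O ∷ O ∷ [] , I ∷ O ∷ O ∷ I ∷ I ∷ I ∷ O ∷ O ∷ []) ∷
   (I ∷ I ∷ O ∷ I ∷ I ∷ O ∷ O ∷ O ∷ [] , I ∷ I ∷ O ∷ I ∷ I ∷ O ∷ O ∷ I ∷ []) ∷
   (I ∷ O ∷ O ∷ I ∷ I ∷ O ∷ O ∷ I ∷ [] , I ∷ O ∷ O ∷ I ∷ I ∷ I ∷ O ∷ I ∷ []) ∷ [])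
  _

flippable-δ : Flippable 3 δ
flippable-δ = flippable-by-evaluation 3 δ
  ((I ∷ I ∷ I ∷ O ∷ O ∷ O ∷ []) ∷ (I ∷ I ∷ I ∷ O ∷ O ∷ I ∷ []) ∷ (I ∷ I ∷ O ∷ O ∷ O ∷ I ∷ []) ∷
   (I ∷ I ∷ O ∷ O ∷ I ∷ I ∷ []) ∷ (O ∷ I ∷ O ∷ O ∷ I ∷ I ∷ []) ∷ (O ∷ I ∷ I ∷ O ∷ I ∷ I ∷ []) ∷
   (O ∷ I ∷ I ∷ O ∷ I ∷ O ∷ []) ∷ (I ∷ I ∷ I ∷ O ∷ I ∷ O ∷ []) ∷ [])
  ((I ∷ I ∷ I ∷ O ∷ O ∷ O ∷ [] , I ∷ I ∷ I ∷ O ∷ O ∷ I ∷ []) ∷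
   (I ∷ I ∷ O ∷ O ∷ O ∷ I ∷ [] , I ∷ I ∷ O ∷ O ∷ I ∷ I ∷ []) ∷
   (O ∷ I ∷ I ∷ O ∷ I ∷ I ∷ [] , O ∷ I ∷ O ∷ O ∷ I ∷ I ∷ []) ∷
   (I ∷ I ∷ I ∷ O ∷ I ∷ O ∷ [] , O ∷ I ∷ I ∷ O ∷ I ∷ O ∷ []) ∷ [])
  _

lemma8 : ((j : ℕ) → (w : Bits) → InD j w → Flippable (j + 3) (α w))
         × Flippable 3 β × Flippable 4 γ × Flippable 3 δ
lemma8 = flippable-α , flippable-β , flippable-γ , flippable-δ
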